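{- For every integer $n$, \[ \sum_{j\geq 0} p(n-4\pi_j) \equiv \begin{cases} 1 \pmod 2 & \text{if } n \text{ is a triangular number},\\ 0 \pmod 2 & \text{otherwise},\end{cases} \] where $\pi_j = \frac38 j^2 + \frac{3-(-1)^j}{8}j + \frac{1-(-1)^j}{16}$ is the $j$th generalized pentagonal number ($\pi_0=0,\pi_1=1,\pi_2=2,\pi_3=5,\pi_4=7,\dots$).
   Context: $p(n)$ denotes the number of partitions of the integer $n$, with $p(0)=1$ and $p(n)=0$ for $n<0$. Triangular numbers are $k(k+1)/2$ for integers $k\ge0$. -}

module Defs where

open import Data.Nat using (ℕ; zero; suc; _+_; _*_; _∸_; _≤ᵇ_; _/_; _%_)
open import Data.Nat.Base using (_≡ᵇ_)
open import Data.Bool using (if_then_else_)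
open import Data.List using (List; map; upTo)
open import Data.Nat.ListAction using (sum)
open import Data.Integer using (ℤ; +_; -[1+_])
open import Data.Product using (∃)
open import Relation.Binary.PropositionalEquality using (_≡_)

-- A partition of n with parts ≤ k+1 is determined by the multiplicity i of
-- the part (k+1) (with i*(k+1) ≤ n) together with a partition of
-- n - i*(k+1) into parts ≤ k.
partsAtMost : ℕ → ℕ → ℕ
partsAtMost zero    n = if n ≡ᵇ 0 then 1 else 0
partsAtMost (suc k) n =
  sum (map (λ i → if i * suc k ≤ᵇ n then partsAtMost k (n ∸ i * suc k) else 0)
           (upTo (suc n)))

-- p(n): number of partitions of n (p 0 = 1); every part of a partition of n is ≤ n.
p : ℕ → ℕ
p n = partsAtMost n n

pℤ : ℤ → ℕ
pℤ (+ n)     = p n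
pℤ -[1+ n ]  = 0

-- j-th generalized pentagonal number:
-- π_j = (6 j² + 2(3 - (-1)^j) j + (1 - (-1)^j)) / 16.
genPent : ℕ → ℕ
genPent j = if j % 2 ≡ᵇ 0
            then (6 * (j * j) + 4 * j) / 16
            else (6 * (j * j) + 8 * j + 2) / 16

sumBelow : ℕ → (ℕ → ℕ) → ℕ
sumBelow M f = sum (map f (upTo M))

IsTriangular : ℤ → Set
IsTriangular n = ∃ λ k → n ≡ + ((k * suc k) / 2)

-- Read as a statement about power series over F₂, the theorem says
--     Σ_j q^(4π_j) · Σ_m p(m) qᵐ  ≡  Σ_k q^(k(k+1)/2)   (mod 2).
-- Multiplying by (q; q)_∞ ≡ ∏_{i ≥ 1} (1 + qⁱ) turns the partition series into 1, and by Euler's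
-- pentagonal theorem Σ_j q^(4π_j) ≡ (q⁴; q⁴)_∞.  By Euler's identity (q; q)_∞ (-q; q²)_∞ = 1 this
-- equals (q; q)_∞ · (q⁴; q⁴)_∞ (-q; q²)_∞, and by Gauss's identity the last factor is Σ_k q^(k(k+1)/2);
-- cancelling (q; q)_∞ gives the claim.  The pentagonal theorem and Gauss's identity are both
-- instances (a, b = 4, 8 and 1, 3) of Jacobi's triple product, which is proved mod 2 from the
-- q-binomial theorem.
--
-- Everything is finite and constructive: a series is its coefficient function ℕ → Bool, products
-- have finitely many factors, identities hold modulo q^(d+1) (written ≈[ d ]), and multiplying by a
-- fixed series is an operator ("multiplier"), so no series multiplication is ever defined.
module Submission where

module Mod2Series where

  open import Algebra.Bundles using (CommutativeRing; CommutativeMonoid)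
  import Algebra.Properties.CommutativeSemigroup as CommSemigroupProperties
  open import Data.Bool using (Bool; true; false; _xor_; not; if_then_else_; T)
  open import Data.Bool.Properties using (not-involutive; not-distribˡ-xor; xor-∧-commutativeRing; xor-assoc; xor-comm; xor-same; xor-identityʳ)
  open import Data.List using (map; applyUpTo)
  open import Data.Nat using (ℕ; zero; suc; >-nonZero; _+_; _*_; _∸_; _≤_; _<_; z≤n; s≤s; _<?_; _≤?_; _≤ᵇ_; _≡ᵇ_; _/_; _%_)
  open import Data.Nat.DivMod using (m*n/n≡m; m*n%n≡0; [m+kn]%n≡m%n)
  open import Data.Nat.ListAction using (sum)
  open import Data.Nat.Properties
  open import Data.Nat.Tactic.RingSolver using (solve-∀)
  open import Data.Product using (_,_; ∃)
  open import Data.Sum using (_⊎_; inj₁; inj₂)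
  open import Data.Unit using (tt)
  open import Function using (_∘_)
  open import Relation.Binary.Bundles using (Setoid)
  open import Relation.Binary.Definitions using (tri<; tri≈; tri>)
  open import Relation.Binary.PropositionalEquality using (_≡_; _≢_; refl; sym; trans; cong; cong₂; subst; module ≡-Reasoning)
  import Relation.Binary.Reasoning.Setoid as SetoidReasoning
  open import Relation.Nullary using (yes; no)
  open import Relation.Nullary.Negation using (contradiction)

  open import Defs using (partsAtMost; genPent) renaming (p to partitions)

  Series : Set
  Series = ℕ → Bool

  infix  4 _≈_ _≈[_]_
  infixl 6 _⊕_

  _≈_ : Series → Series → Set
  f ≈ g = ∀ n → f n ≡ g n

  _≈[_]_ : Series → ℕ → Series → Set
  f ≈[ d ] g = ∀ n → n ≤ d → f n ≡ g n

  ≈-setoid : Setoid _ _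
  ≈-setoid = record
    { Carrier = Series ; _≈_ = _≈_
    ; isEquivalence = record { refl = λ _ → refl ; sym = λ p n → sym (p n) ; trans = λ p q n → trans (p n) (q n) } }

  ≈[]-refl : ∀ {f d} → f ≈[ d ] f
  ≈[]-refl _ _ = refl

  ≈[]-sym : ∀ {f g d} → f ≈[ d ] g → g ≈[ d ] f
  ≈[]-sym p n h = sym (p n h)

  ≈[]-trans : ∀ {f g h d} → f ≈[ d ] g → g ≈[ d ] h → f ≈[ d ] h
  ≈[]-trans p q n h = trans (p n h) (q n h)

  ≈[_]-setoid : ℕ → Setoid _ _
  ≈[ d ]-setoid = record
    { Carrier = Series ; _≈_ = _≈[ d ]_
    ; isEquivalence = record { refl = ≈[]-refl ; sym = ≈[]-sym ; trans = ≈[]-trans } }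

  open Setoid ≈-setoid using () renaming (refl to ≈-refl; sym to ≈-sym; trans to ≈-trans; reflexive to ≈-reflexive)
  module ≈-Reasoning = SetoidReasoning ≈-setoid
  module ≈[_]-Reasoning (d : ℕ) = SetoidReasoning ≈[ d ]-setoid

  ≈⇒≈[] : ∀ {f g d} → f ≈ g → f ≈[ d ] g
  ≈⇒≈[] p n _ = p n

  _⊕_ : Series → Series → Series
  (f ⊕ g) n = f n xor g n

  𝟘 : Series
  𝟘 _ = false

  𝟙 : Series
  𝟙 zero    = true
  𝟙 (suc _) = false

  ⊕-cong : ∀ {f f′ g g′} → f ≈ f′ → g ≈ g′ → f ⊕ g ≈ f′ ⊕ g′
  ⊕-cong p q n = cong₂ _xor_ (p n) (q n)

  ⊕-congᵗ : ∀ {f f′ g g′ d} → f ≈[ d ] f′ → g ≈[ d ] g′ → f ⊕ g ≈[ d ] f′ ⊕ g′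
  ⊕-congᵗ p q n h = cong₂ _xor_ (p n h) (q n h)

  ⊕-comm : ∀ f g → f ⊕ g ≈ g ⊕ f
  ⊕-comm f g n = xor-comm (f n) (g n)

  ⊕-assoc : ∀ f g h → f ⊕ g ⊕ h ≈ f ⊕ (g ⊕ h)
  ⊕-assoc f g h n = xor-assoc (f n) (g n) (h n)

  ⊕-identityʳ : ∀ f → f ⊕ 𝟘 ≈ f
  ⊕-identityʳ f n = xor-identityʳ (f n)

  ⊕-self : ∀ f → f ⊕ f ≈ 𝟘
  ⊕-self f n = xor-same (f n)

  ⊕-interchange : ∀ a b c d → (a ⊕ b) ⊕ (c ⊕ d) ≈ (a ⊕ c) ⊕ (b ⊕ d)
  ⊕-interchange a b c d n = interchange (a n) (b n) (c n) (d n)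
    where
    open CommSemigroupProperties
      (CommutativeMonoid.commutativeSemigroup (CommutativeRing.+-commutativeMonoid xor-∧-commutativeRing))
      using (interchange)

  ⊕-cancel-middle : ∀ f g h → (f ⊕ g) ⊕ (g ⊕ h) ≈ f ⊕ h
  ⊕-cancel-middle f g h = ≈-trans (⊕-assoc f g (g ⊕ h))
    (⊕-cong (≈-refl {f}) (≈-trans (≈-sym (⊕-assoc g g h)) (⊕-cong (⊕-self g) (≈-refl {h}))))

  ⊕-cancel : ∀ f g → f ⊕ g ⊕ g ≈ f
  ⊕-cancel f g = ≈-trans (⊕-assoc f g g) (≈-trans (⊕-cong (≈-refl {f}) (⊕-self g)) (⊕-identityʳ f))

  shift : ℕ → Series → Series
  shift zero    f n       = f n
  shift (suc e) f zero    = false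
  shift (suc e) f (suc n) = shift e f n

  shift-below : ∀ e f n → n < e → shift e f n ≡ false
  shift-below (suc e) f zero    _         = refl
  shift-below (suc e) f (suc n) (s≤s n<e) = shift-below e f n n<e

  shift-at : ∀ e f n → shift e f (e + n) ≡ f n
  shift-at zero    f n = refl
  shift-at (suc e) f n = shift-at e f n

  shift-≡ : ∀ {e e′} f → e ≡ e′ → shift e f ≈ shift e′ f
  shift-≡ f refl = ≈-refl

  shift-+ : ∀ a b f → shift a (shift b f) ≈ shift (a + b) f
  shift-+ zero    b f n       = refl
  shift-+ (suc a) b f zero    = refl
  shift-+ (suc a) b f (suc n) = shift-+ a b f n

  shift-⊕ : ∀ e f g → shift e (f ⊕ g) ≈ shift e f ⊕ shift e g
  shift-⊕ zero    f g n       = refl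
  shift-⊕ (suc e) f g zero    = refl
  shift-⊕ (suc e) f g (suc n) = shift-⊕ e f g n

  shift-raises : ∀ c {f g e d} → f ≈[ e ] g → d ≤ c + e → shift c f ≈[ d ] shift c g
  shift-raises zero    p d≤e n       n≤d       = p n (≤-trans n≤d d≤e)
  shift-raises (suc c) p d≤   zero    _         = refl
  shift-raises (suc c) p d≤   (suc n) (s≤s n≤d) = shift-raises c p (≤-trans n≤d (≤-pred d≤)) n ≤-refl

  shift-cancel : ∀ c {f g d} → shift c f ≈[ c + d ] shift c g → f ≈[ d ] g
  shift-cancel c {f} {g} p n n≤d =
    trans (sym (shift-at c f n)) (trans (p (c + n) (+-monoʳ-≤ c n≤d)) (shift-at c g n))

  shift-vanishes : ∀ e f {d} → d < e → shift e f ≈[ d ] 𝟘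
  shift-vanishes e f d<e n n≤d = shift-below e f n (≤-<-trans n≤d d<e)

  monomial-at : ∀ e → shift e 𝟙 e ≡ true
  monomial-at e = subst (λ x → shift e 𝟙 x ≡ true) (+-identityʳ e) (shift-at e 𝟙 0)

  monomial-off : ∀ e n → e ≢ n → shift e 𝟙 n ≡ false
  monomial-off zero    zero    e≢n = contradiction refl e≢n
  monomial-off zero    (suc n) _   = refl
  monomial-off (suc e) zero    _   = refl
  monomial-off (suc e) (suc n) e≢n = monomial-off e n (e≢n ∘ cong suc)

  ⨁ : ℕ → (ℕ → Series) → Series
  ⨁ zero    F = 𝟘
  ⨁ (suc R) F = F 0 ⊕ ⨁ R (F ∘ suc)

  ⨁-cong : ∀ R {F G} → (∀ i → i < R → F i ≈ G i) → ⨁ R F ≈ ⨁ R G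
  ⨁-cong zero    p = ≈-refl
  ⨁-cong (suc R) p = ⊕-cong (p 0 (s≤s z≤n)) (⨁-cong R (λ i i<R → p (suc i) (s≤s i<R)))

  ⨁-congᵗ : ∀ R {F G d} → (∀ i → i < R → F i ≈[ d ] G i) → ⨁ R F ≈[ d ] ⨁ R G
  ⨁-congᵗ zero    p = ≈[]-refl
  ⨁-congᵗ (suc R) p = ⊕-congᵗ (p 0 (s≤s z≤n)) (⨁-congᵗ R (λ i i<R → p (suc i) (s≤s i<R)))

  ⨁-⊕ : ∀ R F G → ⨁ R (λ i → F i ⊕ G i) ≈ ⨁ R F ⊕ ⨁ R G
  ⨁-⊕ zero    F G n = refl
  ⨁-⊕ (suc R) F G = ≈-trans (⊕-cong (≈-refl {F 0 ⊕ G 0}) (⨁-⊕ R (F ∘ suc) (G ∘ suc)))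
                              (⊕-interchange (F 0) (G 0) (⨁ R (F ∘ suc)) (⨁ R (G ∘ suc)))

  ⨁-split : ∀ m k F → ⨁ (m + k) F ≈ ⨁ m F ⊕ ⨁ k (λ i → F (m + i))
  ⨁-split zero    k F n = refl
  ⨁-split (suc m) k F = ≈-trans (⊕-cong (≈-refl {F 0}) (⨁-split m k (F ∘ suc)))
                                (≈-sym (⊕-assoc (F 0) (⨁ m (F ∘ suc)) _))

  ⨁-snoc : ∀ R F → ⨁ (suc R) F ≈ ⨁ R F ⊕ F R
  ⨁-snoc zero    F = ⊕-comm (F 0) 𝟘
  ⨁-snoc (suc R) F = ≈-trans (⊕-cong (≈-refl {F 0}) (⨁-snoc R (F ∘ suc)))
                              (≈-sym (⊕-assoc (F 0) (⨁ R (F ∘ suc)) (F (suc R))))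

  ⨁-vanishes : ∀ R F {d} → (∀ i → i < R → F i ≈[ d ] 𝟘) → ⨁ R F ≈[ d ] 𝟘
  ⨁-vanishes R F p = ≈[]-trans (⨁-congᵗ R p) (≈⇒≈[] (⨁-zero R))
    where
    ⨁-zero : ∀ R → ⨁ R (λ _ → 𝟘) ≈ 𝟘
    ⨁-zero zero    n = refl
    ⨁-zero (suc R) = ⨁-zero R

  ⨁-reverse : ∀ R F → ⨁ R F ≈ ⨁ R (λ i → F (R ∸ suc i))
  ⨁-reverse zero    F = ≈-refl
  ⨁-reverse (suc R) F = begin
    F 0 ⊕ ⨁ R (F ∘ suc)                     ≈⟨ ⊕-cong (≈-refl {F 0}) (⨁-reverse R (F ∘ suc)) ⟩
    F 0 ⊕ ⨁ R (λ i → F (suc (R ∸ suc i)))   ≈⟨ ⊕-cong (≈-refl {F 0}) (⨁-cong R (λ i i<R → ≈-reflexive (cong F (sym (+-∸-assoc 1 i<R))))) ⟩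
    F 0 ⊕ ⨁ R (λ i → F (R ∸ i))             ≈⟨ ⊕-comm (F 0) _ ⟩
    ⨁ R (λ i → F (R ∸ i)) ⊕ F 0             ≈⟨ ⊕-cong (≈-refl {⨁ R (λ i → F (R ∸ i))}) (≈-reflexive (cong F (sym (n∸n≡0 R)))) ⟩
    ⨁ R (λ i → F (R ∸ i)) ⊕ F (R ∸ R)       ≈⟨ ≈-sym (⨁-snoc R (λ i → F (R ∸ i))) ⟩
    ⨁ (suc R) (λ i → F (R ∸ i))             ∎
    where open ≈-Reasoning

  ⨁-pairs : ∀ K G → ⨁ (suc (K * 2)) G ≈ G 0 ⊕ ⨁ K (λ t → G (suc (t * 2)) ⊕ G (suc (suc (t * 2))))
  ⨁-pairs zero    G = ≈-refl
  ⨁-pairs (suc K) G = ⊕-cong (≈-refl {G 0})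
    (≈-trans (⊕-cong (≈-refl {G 1}) (⨁-pairs K (G ∘ suc ∘ suc))) (≈-sym (⊕-assoc (G 1) (G 2) _)))

  ⨁-truncate : ∀ R R′ F d → d < R → d < R′ → (∀ j → d < j → F j ≈[ d ] 𝟘) → ⨁ R F ≈[ d ] ⨁ R′ F
  ⨁-truncate R R′ F d d<R d<R′ tail = ≈[]-trans (drop-tail R d<R) (≈[]-sym (drop-tail R′ d<R′))
    where
    drop-tail : ∀ R → d < R → ⨁ R F ≈[ d ] ⨁ (suc d) F
    drop-tail R d<R with m≤n⇒∃[o]m+o≡n d<R
    ... | k , refl = ≈[]-trans (≈⇒≈[] (⨁-split (suc d) k F))
      (≈[]-trans (⊕-congᵗ (≈[]-refl {⨁ (suc d) F}) (⨁-vanishes k _ (λ i _ → tail (suc d + i) (s≤s (m≤m+n d i)))))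
                 (≈⇒≈[] (⊕-identityʳ _)))

  -- Operators that behave like multiplication by a fixed power series: additive,
  -- commuting with multiplication by q, and causal (the coefficients of L f up to
  -- degree d depend only on those of f up to degree d).
  record IsMultiplier (L : Series → Series) : Set where
    field
      respᵗ     : ∀ {f g d} → f ≈[ d ] g → L f ≈[ d ] L g
      ⊕-hom     : ∀ f g → L (f ⊕ g) ≈ L f ⊕ L g
      shift-hom : ∀ e f → L (shift e f) ≈ shift e (L f)

    resp : ∀ {f g} → f ≈ g → L f ≈ L g
    resp p n = respᵗ (≈⇒≈[] p) n ≤-refl

    𝟘-hom : L 𝟘 ≈ 𝟘
    𝟘-hom n = trans (⊕-hom 𝟘 𝟘 n) (xor-same (L 𝟘 n))

    ⨁-hom : ∀ R F → L (⨁ R F) ≈ ⨁ R (L ∘ F)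
    ⨁-hom zero    F = 𝟘-hom
    ⨁-hom (suc R) F = ≈-trans (⊕-hom (F 0) (⨁ R (F ∘ suc))) (⊕-cong (≈-refl {L (F 0)}) (⨁-hom R (F ∘ suc)))

  ∘-multiplier : ∀ {L M} → IsMultiplier L → IsMultiplier M → IsMultiplier (L ∘ M)
  ∘-multiplier {L} {M} isL isM = record
    { respᵗ     = λ p → L.respᵗ (M.respᵗ p)
    ; ⊕-hom     = λ f g → ≈-trans (L.resp (M.⊕-hom f g)) (L.⊕-hom (M f) (M g))
    ; shift-hom = λ e f → ≈-trans (L.resp (M.shift-hom e f)) (L.shift-hom e (M f))
    }
    where
    module L = IsMultiplier isL
    module M = IsMultiplier isM

  shift-comm : ∀ a b f → shift a (shift b f) ≈ shift b (shift a f)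
  shift-comm a b f = ≈-trans (shift-+ a b f) (≈-trans (shift-≡ f (+-comm a b)) (≈-sym (shift-+ b a f)))

  shift-multiplier : ∀ e → IsMultiplier (shift e)
  shift-multiplier e = record
    { respᵗ     = λ {f} {g} {d} p → shift-raises e p (m≤n+m d e)
    ; ⊕-hom     = shift-⊕ e
    ; shift-hom = λ a f → shift-comm e a f
    }

  shift-resp : ∀ e {f g} → f ≈ g → shift e f ≈ shift e g
  shift-resp e = IsMultiplier.resp (shift-multiplier e)

  ⨁-multiplier : ∀ R {L : ℕ → Series → Series} → (∀ j → IsMultiplier (L j)) → IsMultiplier (λ f → ⨁ R (λ j → L j f))
  ⨁-multiplier R {L} isL = record
    { respᵗ     = λ p → ⨁-congᵗ R (λ j _ → IsMultiplier.respᵗ (isL j) p)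
    ; ⊕-hom     = λ f g → ≈-trans (⨁-cong R (λ j _ → IsMultiplier.⊕-hom (isL j) f g)) (⨁-⊕ R (λ j → L j f) (λ j → L j g))
    ; shift-hom = λ e f → ≈-trans (⨁-cong R (λ j _ → IsMultiplier.shift-hom (isL j) e f)) (≈-sym (IsMultiplier.⨁-hom (shift-multiplier e) R (λ j → L j f)))
    }

  binom : ℕ → Series → Series
  binom a f = f ⊕ shift a f

  binom-commute : ∀ {L} → IsMultiplier L → ∀ a f → L (binom a f) ≈ binom a (L f)
  binom-commute {L} isL a f = ≈-trans (⊕-hom f (shift a f)) (⊕-cong (≈-refl {L f}) (shift-hom a f))
    where open IsMultiplier isL

  binom-multiplier : ∀ a → IsMultiplier (binom a)
  binom-multiplier a = record
    { respᵗ     = λ p → ⊕-congᵗ p (IsMultiplier.respᵗ (shift-multiplier a) p)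
    ; ⊕-hom     = λ f g → ≈-trans (⊕-cong (≈-refl {f ⊕ g}) (shift-⊕ a f g)) (⊕-interchange f g (shift a f) (shift a g))
    ; shift-hom = λ e f → ≈-sym (binom-commute (shift-multiplier e) a f)
    }

  binom-resp : ∀ a {f g} → f ≈ g → binom a f ≈ binom a g
  binom-resp a = IsMultiplier.resp (binom-multiplier a)

  binom-telescope : ∀ a c f → binom a f ⊕ shift a (binom c f) ≈ binom (a + c) f
  binom-telescope a c f = begin
    (f ⊕ shift a f) ⊕ shift a (f ⊕ shift c f)        ≈⟨ ⊕-cong (≈-refl {f ⊕ shift a f}) (≈-trans (shift-⊕ a f (shift c f)) (⊕-cong (≈-refl {shift a f}) (shift-+ a c f))) ⟩
    (f ⊕ shift a f) ⊕ (shift a f ⊕ shift (a + c) f)  ≈⟨ ⊕-cancel-middle f (shift a f) (shift (a + c) f) ⟩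
    f ⊕ shift (a + c) f                              ∎
    where open ≈-Reasoning

  binom-square : ∀ a f → binom a (binom a f) ≈ binom (a + a) f
  binom-square a = binom-telescope a a

  binom-below : ∀ a f {d} → d < a → binom a f ≈[ d ] f
  binom-below a f d<a n n≤d = trans (cong (f n xor_) (shift-vanishes a f d<a n n≤d)) (xor-identityʳ (f n))

  binom-cancel : ∀ a {f g} d → 0 < a → binom a f ≈[ d ] binom a g → f ≈[ d ] g
  binom-cancel a {f} {g} d 0<a p n n≤d = begin
    f n                           ≡⟨ sym (⊕-cancel f (shift a f) n) ⟩
    binom a f n xor shift a f n   ≡⟨ cong₂ _xor_ (p n n≤d) (shifts-agree d p n n≤d) ⟩
    binom a g n xor shift a g n   ≡⟨ ⊕-cancel g (shift a g) n ⟩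
    g n                           ∎
    where
    open ≡-Reasoning
    shifts-agree : ∀ d → binom a f ≈[ d ] binom a g → shift a f ≈[ d ] shift a g
    shifts-agree zero    _ = ≈[]-trans (shift-vanishes a f 0<a) (≈[]-sym (shift-vanishes a g 0<a))
    shifts-agree (suc d) p = shift-raises a (binom-cancel a d 0<a (λ n n≤d → p n (m≤n⇒m≤1+n n≤d))) (+-monoˡ-≤ d 0<a)

  monomial-pair : ∀ x z f → shift x f ⊕ shift (x + z) f ≈ shift x (binom z f)
  monomial-pair x z f = ≈-sym (≈-trans (shift-⊕ x f (shift z f)) (⊕-cong (≈-refl {shift x f}) (shift-+ x z f)))

  ∏ : ℕ → (ℕ → ℕ) → Series → Series
  ∏ zero    g f = f
  ∏ (suc n) g f = binom (g 0) (∏ n (g ∘ suc) f)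

  ∏-multiplier : ∀ n g → IsMultiplier (∏ n g)
  ∏-multiplier zero    g = record { respᵗ = λ p → p ; ⊕-hom = λ _ _ → ≈-refl ; shift-hom = λ _ _ → ≈-refl }
  ∏-multiplier (suc n) g = ∘-multiplier (binom-multiplier (g 0)) (∏-multiplier n (g ∘ suc))

  ∏-resp : ∀ n g {f f′} → f ≈ f′ → ∏ n g f ≈ ∏ n g f′
  ∏-resp n g = IsMultiplier.resp (∏-multiplier n g)

  ∏-respᵗ : ∀ n g {f f′ d} → f ≈[ d ] f′ → ∏ n g f ≈[ d ] ∏ n g f′
  ∏-respᵗ n g = IsMultiplier.respᵗ (∏-multiplier n g)

  ∏-commute : ∀ {L} → IsMultiplier L → ∀ n g f → L (∏ n g f) ≈ ∏ n g (L f)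
  ∏-commute isL zero    g f = ≈-refl
  ∏-commute isL (suc n) g f = ≈-trans (binom-commute isL (g 0) _) (binom-resp (g 0) (∏-commute isL n (g ∘ suc) f))

  binom-commute′ : ∀ a n g f → binom a (∏ n g f) ≈ ∏ n g (binom a f)
  binom-commute′ a = ∏-commute (binom-multiplier a)

  ∏-ext : ∀ n {g h} f → (∀ i → i < n → g i ≡ h i) → ∏ n g f ≈ ∏ n h f
  ∏-ext zero    f p = ≈-refl
  ∏-ext (suc n) {g} {h} f p = ≈-trans (binom-resp (g 0) (∏-ext n f (λ i i<n → p (suc i) (s≤s i<n))))
                                      (≈-reflexive (cong (λ a → binom a (∏ n (h ∘ suc) f)) (p 0 (s≤s z≤n))))

  ∏-split : ∀ m k g f → ∏ (m + k) g f ≈ ∏ m g (∏ k (λ i → g (m + i)) f)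
  ∏-split zero    k g f = ≈-refl
  ∏-split (suc m) k g f = binom-resp (g 0) (∏-split m k (g ∘ suc) f)

  ∏-snoc : ∀ n g f → ∏ (suc n) g f ≈ ∏ n g (binom (g n) f)
  ∏-snoc zero    g f = ≈-refl
  ∏-snoc (suc n) g f = binom-resp (g 0) (∏-snoc n (g ∘ suc) f)

  ∏-pairs : ∀ n g f → ∏ (n * 2) g f ≈ ∏ n (λ t → g (t * 2)) (∏ n (λ t → g (suc (t * 2))) f)
  ∏-pairs zero    g f = ≈-refl
  ∏-pairs (suc n) g f = binom-resp (g 0) (≈-trans (binom-resp (g 1) (∏-pairs n (g ∘ suc ∘ suc) f))
                                                  (binom-commute′ (g 1) n _ _))

  ∏-triples : ∀ n g f →
    ∏ (n * 3) g f ≈ ∏ n (λ t → g (t * 3)) (∏ n (λ t → g (suc (t * 3))) (∏ n (λ t → g (suc (suc (t * 3)))) f))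
  ∏-triples zero    g f = ≈-refl
  ∏-triples (suc n) g f = binom-resp (g 0) (≈-trans
    (binom-resp (g 1) (≈-trans (binom-resp (g 2) (∏-triples n (g ∘ suc ∘ suc ∘ suc) f))
                               (≈-trans (binom-commute′ (g 2) n _ _) (∏-resp n _ (binom-commute′ (g 2) n _ _)))))
    (binom-commute′ (g 1) n _ _))

  ∏-square : ∀ n g f → ∏ n g (∏ n g f) ≈ ∏ n (λ i → g i + g i) f
  ∏-square zero    g f = ≈-refl
  ∏-square (suc n) g f = begin
    binom a (∏ n g′ (binom a (∏ n g′ f)))   ≈⟨ binom-resp a (≈-sym (binom-commute′ a n g′ (∏ n g′ f))) ⟩
    binom a (binom a (∏ n g′ (∏ n g′ f)))   ≈⟨ binom-square a (∏ n g′ (∏ n g′ f)) ⟩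
    binom (a + a) (∏ n g′ (∏ n g′ f))       ≈⟨ binom-resp (a + a) (∏-square n g′ f) ⟩
    binom (a + a) (∏ n (λ i → g′ i + g′ i) f) ∎
    where
    open ≈-Reasoning
    a : ℕ
    a = g 0
    g′ : ℕ → ℕ
    g′ = g ∘ suc

  ∏-below : ∀ n g f {d} → (∀ i → i < n → d < g i) → ∏ n g f ≈[ d ] f
  ∏-below zero    g f p = ≈[]-refl
  ∏-below (suc n) g f p = ≈[]-trans (binom-below (g 0) _ (p 0 (s≤s z≤n)))
                                     (∏-below n (g ∘ suc) f (λ i i<n → p (suc i) (s≤s i<n)))

  ∏-cancel : ∀ n g {f f′ d} → (∀ i → i < n → 0 < g i) → ∏ n g f ≈[ d ] ∏ n g f′ → f ≈[ d ] f′
  ∏-cancel zero    g p q = q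
  ∏-cancel (suc n) g p q =
    ∏-cancel n (g ∘ suc) (λ i i<n → p (suc i) (s≤s i<n)) (binom-cancel (g 0) _ (p 0 (s≤s z≤n)) q)

  parity : ℕ → Bool
  parity zero    = false
  parity (suc n) = not (parity n)

  parity-+ : ∀ x y → parity (x + y) ≡ parity x xor parity y
  parity-+ zero    y = refl
  parity-+ (suc x) y = trans (cong not (parity-+ x y)) (not-distribˡ-xor (parity x) (parity y))

  Σ< : ℕ → (ℕ → ℕ) → ℕ
  Σ< zero    f = 0
  Σ< (suc L) f = f 0 + Σ< L (f ∘ suc)

  sum-applyUpTo : ∀ L (φ f : ℕ → ℕ) → sum (map f (applyUpTo φ L)) ≡ Σ< L (f ∘ φ)
  sum-applyUpTo zero    φ f = refl
  sum-applyUpTo (suc L) φ f = cong (f (φ 0) +_) (sum-applyUpTo L (φ ∘ suc) f)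

  Σ<-cong : ∀ L {f g} → (∀ i → i < L → f i ≡ g i) → Σ< L f ≡ Σ< L g
  Σ<-cong zero    p = refl
  Σ<-cong (suc L) p = cong₂ _+_ (p 0 (s≤s z≤n)) (Σ<-cong L (λ i i<L → p (suc i) (s≤s i<L)))

  Σ<-vanishes : ∀ L f → (∀ i → i < L → f i ≡ 0) → Σ< L f ≡ 0
  Σ<-vanishes L f p = trans (Σ<-cong L p) (zeros L)
    where
    zeros : ∀ L → Σ< L (λ _ → 0) ≡ 0
    zeros zero    = refl
    zeros (suc L) = zeros L

  Σ<-extend : ∀ L M f → (∀ i → L ≤ i → f i ≡ 0) → Σ< (L + M) f ≡ Σ< L f
  Σ<-extend zero    M f p = Σ<-vanishes M f (λ i _ → p i z≤n)
  Σ<-extend (suc L) M f p = cong (f 0 +_) (Σ<-extend L M (f ∘ suc) (λ i L≤i → p (suc i) (s≤s L≤i)))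

  parity-Σ< : ∀ M f (F : ℕ → Series) n → (∀ j → parity (f j) ≡ F j n) → parity (Σ< M f) ≡ ⨁ M F n
  parity-Σ< zero    f F n p = refl
  parity-Σ< (suc M) f F n p =
    trans (parity-+ (f 0) _) (cong₂ _xor_ (p 0) (parity-Σ< M (f ∘ suc) (F ∘ suc) n (p ∘ suc)))

  if-≤ᵇ-yes : ∀ {A : Set} x y (P Q : A) → x ≤ y → (if x ≤ᵇ y then P else Q) ≡ P
  if-≤ᵇ-yes x y P Q x≤y with x ≤ᵇ y | ≤⇒≤ᵇ x≤y
  ... | true | _ = refl

  if-≤ᵇ-no : ∀ {A : Set} x y (P Q : A) → y < x → (if x ≤ᵇ y then P else Q) ≡ Q
  if-≤ᵇ-no x y P Q y<x with x ≤ᵇ y in eq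
  ... | false = refl
  ... | true  = contradiction (≤ᵇ⇒≤ x y (subst T (sym eq) tt)) (<⇒≱ y<x)

  -- A partition of n into parts
  -- ≤ m = k + 1 either has no part m, or removing one part m leaves a partition of
  -- n ∸ m into parts ≤ m.  In Defs the count is a sum over the multiplicity i of m.
  module PartsRecurrence (k : ℕ) where

    m : ℕ
    m = suc k

    summand : ℕ → ℕ → ℕ
    summand n i = if i * m ≤ᵇ n then partsAtMost k (n ∸ i * m) else 0

    unfold : ∀ n → partsAtMost m n ≡ partsAtMost k n + Σ< n (summand n ∘ suc)
    unfold n = sum-applyUpTo (suc n) (λ i → i) (summand n)

    -- Below m, only multiplicity 0 is possible.
    small : ∀ n → n < m → partsAtMost m n ≡ partsAtMost k n
    small n n<m = trans (unfold n) (trans (cong (partsAtMost k n +_) (Σ<-vanishes n _ too-big)) (+-identityʳ _))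
      where
      too-big : ∀ i → i < n → summand n (suc i) ≡ 0
      too-big i _ = if-≤ᵇ-no (suc i * m) n _ _ (<-≤-trans n<m (m≤m+n m (i * m)))

    -- Removing one part m: the summands for n + m are those for n, shifted by one.
    step : ∀ n → partsAtMost m (m + n) ≡ partsAtMost k (m + n) + partsAtMost m n
    step n = begin
      partsAtMost m (m + n)                               ≡⟨ unfold (m + n) ⟩
      partsAtMost k (m + n) + Σ< (m + n) (summand (m + n) ∘ suc) ≡⟨ cong (partsAtMost k (m + n) +_) (Σ<-cong (m + n) (λ i _ → shifted i)) ⟩
      partsAtMost k (m + n) + Σ< (m + n) (summand n)      ≡⟨ cong (λ L → partsAtMost k (m + n) + Σ< L (summand n)) (cong suc (+-comm k n)) ⟩
      partsAtMost k (m + n) + Σ< (suc n + k) (summand n)  ≡⟨ cong (partsAtMost k (m + n) +_) (Σ<-extend (suc n) k (summand n) vanish) ⟩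
      partsAtMost k (m + n) + Σ< (suc n) (summand n)      ≡⟨ cong (partsAtMost k (m + n) +_) (sym (sum-applyUpTo (suc n) (λ i → i) (summand n))) ⟩
      partsAtMost k (m + n) + partsAtMost m n             ∎
      where
      open ≡-Reasoning
      shifted : ∀ i → summand (m + n) (suc i) ≡ summand n i
      shifted i with i * m ≤? n
      ... | yes le = trans (if-≤ᵇ-yes (m + i * m) (m + n) _ _ (+-monoʳ-≤ m le))
                           (trans (cong (partsAtMost k) ([m+n]∸[m+o]≡n∸o m n (i * m))) (sym (if-≤ᵇ-yes (i * m) n _ _ le)))
      ... | no  gt = trans (if-≤ᵇ-no (m + i * m) (m + n) _ _ (+-monoʳ-< m (≰⇒> gt)))
                           (sym (if-≤ᵇ-no (i * m) n _ _ (≰⇒> gt)))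
      vanish : ∀ i → suc n ≤ i → summand n i ≡ 0
      vanish i n<i = if-≤ᵇ-no (i * m) n _ _ (<-≤-trans n<i (m≤m*n i m))

  -- A partition of n has parts ≤ n, so bounding the parts by K ≥ n changes nothing.
  partsAtMost-stable : ∀ n K → n ≤ K → partsAtMost K n ≡ partitions n
  partsAtMost-stable n K n≤K with m≤n⇒∃[o]m+o≡n n≤K
  ... | j , refl = raise j
    where
    raise : ∀ j → partsAtMost (n + j) n ≡ partsAtMost n n
    raise zero    = cong (λ K → partsAtMost K n) (+-identityʳ n)
    raise (suc j) = trans (cong (λ K → partsAtMost K n) (+-suc n j))
                          (trans (PartsRecurrence.small (n + j) n (s≤s (m≤m+n n j))) (raise j))

  -- The generating function of partitions into parts ≤ K, reduced mod 2;
  -- it is 1 / ∏_{1 ≤ i ≤ K} (1 + qⁱ) over F₂.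
  partsSeries : ℕ → Series
  partsSeries K n = parity (partsAtMost K n)

  partsSeries-0 : partsSeries 0 ≈ 𝟙
  partsSeries-0 zero    = refl
  partsSeries-0 (suc n) = refl

  partsSeries-binom : ∀ k → binom (suc k) (partsSeries (suc k)) ≈ partsSeries k
  partsSeries-binom k n with n <? suc k
  ... | yes n<m = trans (cong (partsSeries (suc k) n xor_) (shift-below (suc k) _ n n<m))
                        (trans (xor-identityʳ _) (cong parity (PartsRecurrence.small k n n<m)))
  ... | no  n≮m with m≤n⇒∃[o]m+o≡n (≮⇒≥ n≮m)
  ...   | n′ , refl = begin
    partsSeries (suc k) (suc k + n′) xor shift (suc k) (partsSeries (suc k)) (suc k + n′)
      ≡⟨ cong₂ _xor_ (trans (cong parity (PartsRecurrence.step k n′)) (parity-+ (partsAtMost k (suc k + n′)) (partsAtMost (suc k) n′))) (shift-at (suc k) _ n′) ⟩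
    (partsSeries k (suc k + n′) xor partsSeries (suc k) n′) xor partsSeries (suc k) n′
      ≡⟨ ⊕-cancel (λ _ → partsSeries k (suc k + n′)) (λ _ → partsSeries (suc k) n′) 0 ⟩
    partsSeries k (suc k + n′) ∎
    where open ≡-Reasoning

  partsSeries-∏ : ∀ K → ∏ K suc (partsSeries K) ≈ 𝟙
  partsSeries-∏ zero    = partsSeries-0
  partsSeries-∏ (suc K) = ≈-trans (∏-snoc K suc (partsSeries (suc K)))
                          (≈-trans (∏-resp K suc (partsSeries-binom K)) (partsSeries-∏ K))

  allBinoms oddBinoms : ℕ → ℕ → Series → Series
  allBinoms c K = ∏ K (λ i → c * suc i)
  oddBinoms c K = ∏ K (λ i → c * suc (i * 2))

  -- Reduction from c to 2c: the factors of ∏_{i ≤ 2K} (1 + q^(ci)) beyond the K-th have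
  -- degree > d; split into odd and even i, the even ones form ∏_{i ≤ K} (1 + q^(2ci)) and
  -- the odd ones square to ∏_{i ≤ K} (1 + q^(2c(2i-1))).
  euler-doubling : ∀ c K f d → d < c * suc K →
    allBinoms c K (oddBinoms c K f) ≈[ d ] allBinoms (c + c) K (oddBinoms (c + c) K f)
  euler-doubling c K f d d<cK = begin
    allBinoms c K O                                           ≈⟨ ∏-respᵗ K _ (≈[]-sym (∏-below K _ O high)) ⟩
    allBinoms c K (∏ K (λ i → c * suc (K + i)) O)             ≈⟨ ≈⇒≈[] (≈-sym (∏-split K K (λ i → c * suc i) O)) ⟩
    ∏ (K + K) (λ i → c * suc i) O                             ≈⟨ ≈⇒≈[] (≈-reflexive (cong (λ n → ∏ n (λ i → c * suc i) O) (trans (cong (K +_) (sym (+-identityʳ K))) (*-comm 2 K)))) ⟩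
    ∏ (K * 2) (λ i → c * suc i) O                             ≈⟨ ≈⇒≈[] (∏-pairs K (λ i → c * suc i) O) ⟩
    oddBinoms c K (∏ K (λ t → c * suc (suc (t * 2))) O)       ≈⟨ ≈⇒≈[] (∏-resp K _ (∏-ext K O (λ t _ → even-exponent c t))) ⟩
    oddBinoms c K (allBinoms (c + c) K O)                     ≈⟨ ≈⇒≈[] (≈-sym (∏-commute (∏-multiplier K _) K _ O)) ⟩
    allBinoms (c + c) K (oddBinoms c K (oddBinoms c K f))     ≈⟨ ≈⇒≈[] (∏-resp K _ (∏-square K _ f)) ⟩
    allBinoms (c + c) K (∏ K (λ i → c * suc (i * 2) + c * suc (i * 2)) f)
                                                              ≈⟨ ≈⇒≈[] (∏-resp K _ (∏-ext K f (λ i _ → odd-exponent c i))) ⟩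
    allBinoms (c + c) K (oddBinoms (c + c) K f)               ∎
    where
    open ≈[_]-Reasoning d
    O : Series
    O = oddBinoms c K f
    high : ∀ i → i < K → d < c * suc (K + i)
    high i _ = <-≤-trans d<cK (*-monoʳ-≤ c (s≤s (m≤m+n K i)))
    even-exponent : ∀ c t → c * suc (suc (t * 2)) ≡ (c + c) * suc t
    even-exponent = solve-∀
    odd-exponent : ∀ c i → c * suc (i * 2) + c * suc (i * 2) ≡ (c + c) * suc (i * 2)
    odd-exponent = solve-∀

  -- Iterating the doubling until c > d, when every factor is 1 modulo q^(d+1).
  euler : ∀ c K f d → 0 < c → d < c * suc K → allBinoms c K (oddBinoms c K f) ≈[ d ] f
  euler c K f d 0<c d<cK = iterate (suc d) c 0<c (m≤n+m (suc d) c) d<cK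
    where
    -- Induction on the fuel F, which bounds the number of doublings still needed.
    iterate : ∀ F c → 0 < c → d < c + F → d < c * suc K → allBinoms c K (oddBinoms c K f) ≈[ d ] f
    iterate F c 0<c d<c+F d<cK with d <? c
    ... | yes d<c = ≈[]-trans (∏-below K _ _ (λ i _ → <-≤-trans d<c (m≤m*n c (suc i))))
                              (∏-below K _ f (λ i _ → <-≤-trans d<c (m≤m*n c (suc (i * 2)))))
    iterate zero    c 0<c d<c+F d<cK | no d≮c = contradiction (subst (d <_) (+-identityʳ c) d<c+F) d≮c
    iterate (suc F) c 0<c d<c+F d<cK | no d≮c =
      ≈[]-trans (euler-doubling c K f d d<cK)
                (iterate F (c + c) (<-≤-trans 0<c (m≤m+n c c)) d<2c+F (<-≤-trans d<cK (*-monoˡ-≤ (suc K) (m≤m+n c c))))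
      where
      d<2c+F : d < (c + c) + F
      d<2c+F = <-≤-trans d<c+F (≤-trans (+-monoʳ-≤ c (+-monoˡ-≤ F 0<c)) (≤-reflexive (sym (+-assoc c c F))))

  -- choose2 r = r (r ∸ 1) / 2 = 0 + 1 + ⋯ + (r ∸ 1).
  choose2 : ℕ → ℕ
  choose2 zero    = 0
  choose2 (suc r) = r + choose2 r

  choose2-+ : ∀ x y → choose2 (x + y) ≡ choose2 x + choose2 y + x * y
  choose2-+ zero    y = sym (+-identityʳ (choose2 y))
  choose2-+ (suc x) y = trans (cong ((x + y) +_) (choose2-+ x y)) (rearrange x y (choose2 x) (choose2 y))
    where
    rearrange : ∀ x y cx cy → (x + y) + (cx + cy + x * y) ≡ (x + cx) + cy + suc x * y
    rearrange = solve-∀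

  choose2-square : ∀ m → m * m ≡ choose2 m + choose2 m + m
  choose2-square zero    = refl
  choose2-square (suc m) = trans (expand m) (trans (cong (_+ (m + m + 1)) (choose2-square m)) (rearrange m (choose2 m)))
    where
    expand : ∀ m → suc m * suc m ≡ m * m + (m + m + 1)
    expand = solve-∀
    rearrange : ∀ m c → (c + c + m) + (m + m + 1) ≡ (m + c) + (m + c) + suc m
    rearrange = solve-∀

  -- Sums over the anti-diagonal: diag m F = ⨁_{u + r = m} F u r.
  diag : ℕ → (ℕ → ℕ → Series) → Series
  diag zero    F = F 0 0
  diag (suc m) F = F (suc m) 0 ⊕ diag m (λ u r → F u (suc r))

  diag-cong : ∀ m {F G} → (∀ u r → F u r ≈ G u r) → diag m F ≈ diag m G
  diag-cong zero    p = p 0 0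
  diag-cong (suc m) p = ⊕-cong (p (suc m) 0) (diag-cong m (λ u r → p u (suc r)))

  diag-⊕ : ∀ m F G → diag m (λ u r → F u r ⊕ G u r) ≈ diag m F ⊕ diag m G
  diag-⊕ zero    F G = ≈-refl
  diag-⊕ (suc m) F G = ≈-trans (⊕-cong (≈-refl {F (suc m) 0 ⊕ G (suc m) 0}) (diag-⊕ m (λ u r → F u (suc r)) (λ u r → G u (suc r))))
                               (⊕-interchange (F (suc m) 0) (G (suc m) 0) _ _)

  diag-hom : ∀ {L} → IsMultiplier L → ∀ m F → L (diag m F) ≈ diag m (λ u r → L (F u r))
  diag-hom isL zero    F = ≈-refl
  diag-hom {L} isL (suc m) F = ≈-trans (IsMultiplier.⊕-hom isL (F (suc m) 0) _)
                                   (⊕-cong (≈-refl {L (F (suc m) 0)}) (diag-hom isL m (λ u r → F u (suc r))))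

  diag-shift : ∀ m (g : ℕ → ℕ) F → diag m (λ u r → shift (g (u + r)) (F u r)) ≈ shift (g m) (diag m F)
  diag-shift zero    g F = ≈-refl
  diag-shift (suc m) g F = begin
    shift (g (suc m + 0)) (F (suc m) 0) ⊕ diag m (λ u r → shift (g (u + suc r)) (F u (suc r)))
      ≈⟨ ⊕-cong (shift-≡ {g (suc m + 0)} (F (suc m) 0) (cong g (+-identityʳ (suc m))))
                (diag-cong m (λ u r → shift-≡ {g (u + suc r)} (F u (suc r)) (cong g (+-suc u r)))) ⟩
    shift (g (suc m)) (F (suc m) 0) ⊕ diag m (λ u r → shift (g (suc (u + r))) (F u (suc r)))
      ≈⟨ ⊕-cong (≈-refl {shift (g (suc m)) (F (suc m) 0)}) (diag-shift m (g ∘ suc) (λ u r → F u (suc r))) ⟩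
    shift (g (suc m)) (F (suc m) 0) ⊕ shift (g (suc m)) (diag m (λ u r → F u (suc r)))
      ≈⟨ ≈-sym (shift-⊕ (g (suc m)) _ _) ⟩
    shift (g (suc m)) (diag (suc m) F) ∎
    where open ≈-Reasoning

  diag-dropʳ : ∀ m F → F 0 (suc m) ≈ 𝟘 → diag (suc m) F ≈ diag m (λ u r → F (suc u) r)
  diag-dropʳ zero    F p = ≈-trans (⊕-cong (≈-refl {F 1 0}) p) (⊕-identityʳ (F 1 0))
  diag-dropʳ (suc m) F p = ⊕-cong (≈-refl {F (suc (suc m)) 0}) (diag-dropʳ m (λ u r → F u (suc r)) p)

  diag-dropˡ : ∀ m F → F (suc m) 0 ≈ 𝟘 → diag (suc m) F ≈ diag m (λ u r → F u (suc r))
  diag-dropˡ m F p = ⊕-cong p (≈-refl {diag m (λ u r → F u (suc r))})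

  diag-as-⨁ : ∀ m F → diag m F ≈ ⨁ (suc m) (λ r → F (m ∸ r) r)
  diag-as-⨁ zero    F = ≈-sym (⊕-identityʳ (F 0 0))
  diag-as-⨁ (suc m) F = ⊕-cong (≈-refl {F (suc m) 0}) (diag-as-⨁ m (λ u r → F u (suc r)))

  -- gauss s u r: the Gaussian binomial coefficient [u + r choose u] in the variable qˢ,
  -- reduced mod 2, given by the q-Pascal recurrence.
  gauss : ℕ → ℕ → ℕ → Series
  gauss s u       zero    = 𝟙
  gauss s zero    (suc r) = 𝟙
  gauss s (suc u) (suc r) = gauss s u (suc r) ⊕ shift (s * suc u) (gauss s (suc u) r)

  gauss-0 : ∀ s r → gauss s 0 r ≈ 𝟙
  gauss-0 s zero    = ≈-refl
  gauss-0 s (suc r) = ≈-refl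

  -- The q-binomial theorem over F₂:
  --   ∏_{i<m} (q^X + q^(Y + s i)) = ⨁_{u + r = m} q^(u X + r Y + s·choose2 r) [u + r choose u]_(qˢ).
  module QBinomial (X Y s : ℕ) where

    linearProd : ℕ → Series
    linearProd zero    = 𝟙
    linearProd (suc m) = shift X (linearProd m) ⊕ shift (Y + s * m) (linearProd m)

    term : ℕ → ℕ → Series
    term u r = shift (u * X + r * Y + s * choose2 r) (gauss s u r)

    -- The contributions to term u r from choosing q^X, resp. q^(Y + s i), in the last factor.
    fromFirst fromSecond : ℕ → ℕ → Series
    fromFirst zero    zero    = 𝟙
    fromFirst zero    (suc r) = 𝟘
    fromFirst (suc u) r       = shift X (term u r)
    fromSecond u zero    = 𝟘
    fromSecond u (suc r) = shift (Y + s * (u + r)) (term u r)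

    -- The q-Pascal recurrence, multiplied by the monomial of term u r.
    term-split : ∀ u r → term u r ≈ fromFirst u r ⊕ fromSecond u r
    term-split zero    zero    = ≈-trans (shift-≡ 𝟙 (*-zeroʳ s)) (≈-sym (⊕-identityʳ 𝟙))
    term-split (suc u) zero    =
      ≈-trans (shift-≡ 𝟙 (e₁ X Y s u)) (≈-trans (≈-sym (shift-+ X _ 𝟙)) (≈-sym (⊕-identityʳ _)))
      where
      e₁ : ∀ X Y s u → (X + u * X) + 0 * Y + s * 0 ≡ X + (u * X + 0 * Y + s * 0)
      e₁ = solve-∀
    term-split zero    (suc r) =
      ≈-trans (shift-≡ 𝟙 (e₂ Y s r (choose2 r)))
              (≈-trans (≈-sym (shift-+ (Y + s * (0 + r)) _ 𝟙)) (shift-resp (Y + s * (0 + r)) (shift-resp (0 + r * Y + s * choose2 r) (≈-sym (gauss-0 s r)))))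
      where
      e₂ : ∀ Y s r c → 0 + (Y + r * Y) + s * (r + c) ≡ Y + s * (0 + r) + (0 + r * Y + s * c)
      e₂ = solve-∀
    term-split (suc u) (suc r) = begin
      shift e (gauss s u (suc r) ⊕ shift (s * suc u) (gauss s (suc u) r))
        ≈⟨ shift-⊕ e _ _ ⟩
      shift e (gauss s u (suc r)) ⊕ shift e (shift (s * suc u) (gauss s (suc u) r))
        ≈⟨ ⊕-cong (≈-trans (shift-≡ (gauss s u (suc r)) (e₃ X Y s u r (choose2 r))) (≈-sym (shift-+ X _ _)))
                  (≈-trans (shift-+ e (s * suc u) _) (≈-trans (shift-≡ (gauss s (suc u) r) (e₄ X Y s u r (choose2 r)))
                                                                 (≈-sym (shift-+ (Y + s * (suc u + r)) _ _)))) ⟩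
      fromFirst (suc u) (suc r) ⊕ fromSecond (suc u) (suc r) ∎
      where
      open ≈-Reasoning
      e : ℕ
      e = suc u * X + suc r * Y + s * choose2 (suc r)
      e₃ : ∀ X Y s u r c → (X + u * X) + (Y + r * Y) + s * (r + c) ≡ X + (u * X + (Y + r * Y) + s * (r + c))
      e₃ = solve-∀
      e₄ : ∀ X Y s u r c → (X + u * X) + (Y + r * Y) + s * (r + c) + s * suc u ≡ Y + s * (suc u + r) + ((X + u * X) + r * Y + s * c)
      e₄ = solve-∀

    -- Induction on m: the last factor q^X + q^(Y + s m) distributes over the sum.
    q-binomial : ∀ m → linearProd m ≈ diag m term
    q-binomial zero    = ≈-sym (shift-≡ 𝟙 (*-zeroʳ s))
    q-binomial (suc m) = begin
      shift X P ⊕ shift (Y + s * m) P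
        ≈⟨ ⊕-cong (shift-resp X (q-binomial m)) (shift-resp (Y + s * m) (q-binomial m)) ⟩
      shift X (diag m term) ⊕ shift (Y + s * m) (diag m term)
        ≈⟨ ⊕-cong (diag-hom (shift-multiplier X) m term) (≈-sym (diag-shift m (λ x → Y + s * x) term)) ⟩
      diag m (λ u r → fromFirst (suc u) r) ⊕ diag m (λ u r → fromSecond u (suc r))
        ≈⟨ ⊕-cong (≈-sym (diag-dropʳ m fromFirst ≈-refl)) (≈-sym (diag-dropˡ m fromSecond ≈-refl)) ⟩
      diag (suc m) fromFirst ⊕ diag (suc m) fromSecond
        ≈⟨ ≈-sym (diag-⊕ (suc m) fromFirst fromSecond) ⟩
      diag (suc m) (λ u r → fromFirst u r ⊕ fromSecond u r)
        ≈⟨ ≈-sym (diag-cong (suc m) term-split) ⟩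
      diag (suc m) term ∎
      where
      open ≈-Reasoning
      P : Series
      P = linearProd m

  -- (qˢ; qˢ)_u [u + r choose u]_(qˢ) = (q^(s(r+1)); qˢ)_u, signs dropped mod 2:
  -- ∏_{i<u} (1 + q^(s(i+1))) · gauss s u r = ∏_{i<u} (1 + q^(s(r+i+1))).
  gauss-∏ : ∀ s u r → ∏ u (λ i → s * suc i) (gauss s u r) ≈ ∏ u (λ i → s * (r + suc i)) 𝟙
  gauss-∏ s zero    r       = gauss-0 s r
  gauss-∏ s (suc u) zero    = ≈-refl
  gauss-∏ s (suc u) (suc r) = begin
    ∏ (suc u) g (gauss s u (suc r) ⊕ shift (s * suc u) (gauss s (suc u) r))
      ≈⟨ ≈-trans (∏ᵤ.⊕-hom (gauss s u (suc r)) _) (⊕-cong (≈-refl {∏ (suc u) g (gauss s u (suc r))}) (∏ᵤ.shift-hom (s * suc u) _)) ⟩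
    ∏ (suc u) g (gauss s u (suc r)) ⊕ shift (s * suc u) (∏ (suc u) g (gauss s (suc u) r))
      ≈⟨ ⊕-cong (≈-trans (∏-snoc u g _) (≈-trans (≈-sym (binom-commute′ (g u) u g _)) (binom-resp (g u) (gauss-∏ s u (suc r)))))
                (shift-resp (s * suc u) (≈-trans (gauss-∏ s (suc u) r)
                                                 (binom-resp (s * (r + 1)) (∏-ext u 𝟙 (λ i _ → cong (s *_) (+-suc r (suc i))))))) ⟩
    binom (s * suc u) Z ⊕ shift (s * suc u) (binom (s * (r + 1)) Z)
      ≈⟨ binom-telescope (s * suc u) (s * (r + 1)) Z ⟩
    binom (s * suc u + s * (r + 1)) Z
      ≈⟨ ≈-reflexive (cong (λ a → binom a Z) (exponent s u r)) ⟩
    binom (h u) Z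
      ≈⟨ binom-commute′ (h u) u h 𝟙 ⟩
    ∏ u h (binom (h u) 𝟙)
      ≈⟨ ≈-sym (∏-snoc u h 𝟙) ⟩
    ∏ (suc u) h 𝟙 ∎
    where
    open ≈-Reasoning
    g h : ℕ → ℕ
    g i = s * suc i
    h i = s * (suc r + suc i)
    Z : Series
    Z = ∏ u h 𝟙
    module ∏ᵤ = IsMultiplier (∏-multiplier (suc u) g)
    exponent : ∀ s u r → s * suc u + s * (r + 1) ≡ s * (suc r + suc u)
    exponent = solve-∀

  gauss-∏-low : ∀ s L u r e → 0 < s → u ≤ L → e ≤ u → e ≤ r → ∏ L (λ i → s * suc i) (gauss s u r) ≈[ e ] 𝟙
  gauss-∏-low s L u r e 0<s u≤L e≤u e≤r with m≤n⇒∃[o]m+o≡n u≤L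
  ... | L′ , refl = begin
    ∏ (u + L′) g (gauss s u r)                          ≈⟨ ≈⇒≈[] (∏-split u L′ g (gauss s u r)) ⟩
    ∏ u g (∏ L′ (λ i → g (u + i)) (gauss s u r))        ≈⟨ ∏-respᵗ u g (∏-below L′ _ _ (λ i _ → high e≤u i)) ⟩
    ∏ u g (gauss s u r)                                 ≈⟨ ≈⇒≈[] (gauss-∏ s u r) ⟩
    ∏ u (λ i → s * (r + suc i)) 𝟙                       ≈⟨ ∏-below u _ 𝟙 (λ i _ → subst (e <_) (cong (s *_) (sym (+-suc r i))) (high e≤r i)) ⟩
    𝟙 ∎
    where
    open ≈[_]-Reasoning e
    g : ℕ → ℕ
    g i = s * suc i
    -- every factor 1 + q^(s (x + i + 1)) with x ≥ e is ≡ 1 modulo q^(e+1)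
    high : ∀ {x} → e ≤ x → ∀ i → e < s * suc (x + i)
    high e≤x i = ≤-trans (s≤s (≤-trans e≤x (m≤m+n _ i))) (m≤n*m (suc (_ + i)) s {{>-nonZero 0<s}})

  -- Jacobi's triple product over F₂, in the finite form needed here: for a, b ≥ 1,
  -- s = a + b and L ≥ 2N, modulo q^(N+1),
  --   ∏_{i<L} (1 + q^(s(i+1))) ∏_{t<N} (1 + q^(a+st)) (1 + q^(b+st))
  --     ≡ ⨁_{0 ≤ k ≤ N} q^(ak + s·choose2 k) + ⨁_{1 ≤ m ≤ N} q^(bm + s·choose2 m).
  -- The product ∏_{i < 2N} (q^(sN) + q^(a+si)) is q^E times the middle product; expanding it
  -- by the q-binomial theorem and multiplying by (qˢ; qˢ)_L, the Gaussian binomials become 1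
  -- up to the relevant degree, leaving the monomials on the right.
  module TripleProduct (a b N : ℕ) where

    -- The period s, the exponents cPlus k = ak + s·choose2 k (k ≥ 0) and
    -- cMinus m = bm + s·choose2 m (m ≥ 1) of the two sums and their monomials, the middle product, and the
    -- overall power q^E that factors out of ∏_{i < 2N} (q^(sN) + q^(a+si)).
    s : ℕ
    s = a + b

    open QBinomial (s * N) a s

    cPlus cMinus : ℕ → ℕ
    cPlus  k = a * k + s * choose2 k
    cMinus m = b * m + s * choose2 m

    plus minus : ℕ → Series
    plus  k = shift (cPlus k) 𝟙
    minus i = shift (cMinus (suc i)) 𝟙

    jacobiProd : Series
    jacobiProd = ∏ N (λ t → a + s * t) (∏ N (λ t → b + s * t) 𝟙)

    E : ℕ
    E = cPlus N + N * (s * N)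

    -- For i < N: q^(sN) + q^(a+si) = q^(a+si) (1 + q^(b + s(N-1-i))).
    linearProd-lower : ∀ i w → i + w ≡ N → linearProd i ≈ shift (cPlus i) (∏ i (λ t → b + s * (w + t)) 𝟙)
    linearProd-lower zero    w _ = ≈-sym (shift-≡ 𝟙 (cong₂ _+_ (*-zeroʳ a) (*-zeroʳ s)))
    linearProd-lower (suc i) w i+w≡N = begin
      shift (s * N) P ⊕ shift (a + s * i) P
        ≈⟨ ⊕-comm (shift (s * N) P) _ ⟩
      shift (a + s * i) P ⊕ shift (s * N) P
        ≈⟨ ⊕-cong (≈-refl {shift (a + s * i) P}) (shift-≡ P sN≡) ⟩
      shift (a + s * i) P ⊕ shift ((a + s * i) + (b + s * w)) P
        ≈⟨ monomial-pair (a + s * i) (b + s * w) P ⟩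
      shift (a + s * i) (binom (b + s * w) P)
        ≈⟨ shift-resp (a + s * i) (binom-resp (b + s * w) (linearProd-lower i (suc w) (trans (+-suc i w) i+w≡N))) ⟩
      shift (a + s * i) (binom (b + s * w) (shift (cPlus i) P′))
        ≈⟨ shift-resp (a + s * i) (≈-sym (binom-commute (shift-multiplier (cPlus i)) (b + s * w) P′)) ⟩
      shift (a + s * i) (shift (cPlus i) (binom (b + s * w) P′))
        ≈⟨ shift-+ (a + s * i) (cPlus i) _ ⟩
      shift (a + s * i + cPlus i) (binom (b + s * w) P′)
        ≈⟨ shift-≡ _ (exponent a b i (choose2 i)) ⟩
      shift (cPlus (suc i)) (binom (b + s * w) P′)
        ≈⟨ shift-resp (cPlus (suc i)) (≈-reflexive (cong (λ x → binom (b + s * x) P′) (sym (+-identityʳ w)))) ⟩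
      shift (cPlus (suc i)) (binom (b + s * (w + 0)) P′)
        ≈⟨ shift-resp (cPlus (suc i)) (binom-resp (b + s * (w + 0)) (∏-ext i 𝟙 (λ t _ → cong (λ x → b + s * x) (sym (+-suc w t))))) ⟩
      shift (cPlus (suc i)) (∏ (suc i) (λ t → b + s * (w + t)) 𝟙) ∎
      where
      open ≈-Reasoning
      P P′ : Series
      P  = linearProd i
      P′ = ∏ i (λ t → b + s * (suc w + t)) 𝟙
      split-sN : ∀ a b i w → (a + b) * (suc i + w) ≡ (a + (a + b) * i) + (b + (a + b) * w)
      split-sN = solve-∀
      sN≡ : s * N ≡ (a + s * i) + (b + s * w)
      sN≡ = trans (cong (s *_) (sym i+w≡N)) (split-sN a b i w)
      exponent : ∀ a b i c → a + (a + b) * i + (a * i + (a + b) * c) ≡ a * suc i + (a + b) * (i + c)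
      exponent = solve-∀

    -- For i = N + j: q^(sN) + q^(a+s(N+j)) = q^(sN) (1 + q^(a+sj)).
    linearProd-upper : ∀ j → linearProd (N + j) ≈ shift (cPlus N + j * (s * N)) (∏ j (λ t → a + s * t) (∏ N (λ t → b + s * t) 𝟙))
    linearProd-upper zero = ≈-trans (≈-reflexive (cong linearProd (+-identityʳ N)))
      (≈-trans (linearProd-lower N 0 (+-identityʳ N)) (shift-≡ _ (sym (+-identityʳ (cPlus N)))))
    linearProd-upper (suc j) = begin
      linearProd (N + suc j)
        ≈⟨ ≈-reflexive (cong linearProd (+-suc N j)) ⟩
      shift (s * N) P ⊕ shift (a + s * (N + j)) P
        ≈⟨ ⊕-cong (≈-refl {shift (s * N) P}) (shift-≡ P (split a b N j)) ⟩
      shift (s * N) P ⊕ shift (s * N + (a + s * j)) P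
        ≈⟨ monomial-pair (s * N) (a + s * j) P ⟩
      shift (s * N) (binom (a + s * j) P)
        ≈⟨ shift-resp (s * N) (binom-resp (a + s * j) (linearProd-upper j)) ⟩
      shift (s * N) (binom (a + s * j) (shift β Q))
        ≈⟨ shift-resp (s * N) (≈-sym (binom-commute (shift-multiplier β) (a + s * j) Q)) ⟩
      shift (s * N) (shift β (binom (a + s * j) Q))
        ≈⟨ shift-+ (s * N) β _ ⟩
      shift (s * N + β) (binom (a + s * j) Q)
        ≈⟨ shift-≡ _ (reorder (cPlus N) (s * N) j) ⟩
      shift (cPlus N + suc j * (s * N)) (binom (a + s * j) Q)
        ≈⟨ shift-resp (cPlus N + suc j * (s * N)) (≈-trans (binom-commute′ (a + s * j) j _ B) (≈-sym (∏-snoc j (λ t → a + s * t) B))) ⟩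
      shift (cPlus N + suc j * (s * N)) (∏ (suc j) (λ t → a + s * t) (∏ N (λ t → b + s * t) 𝟙)) ∎
      where
      open ≈-Reasoning
      P B Q : Series
      P = linearProd (N + j)
      B = ∏ N (λ t → b + s * t) 𝟙
      Q = ∏ j (λ t → a + s * t) B
      β : ℕ
      β = cPlus N + j * (s * N)
      split : ∀ a b N j → a + (a + b) * (N + j) ≡ (a + b) * N + (a + (a + b) * j)
      split = solve-∀
      reorder : ∀ e x j → x + (e + j * x) ≡ e + suc j * x
      reorder = solve-∀

    linearProd-factor : linearProd (N + N) ≈ shift E jacobiProd
    linearProd-factor = linearProd-upper N

    -- The exponents of the surviving terms: r = N + k, u = w, resp. u = N + m, r = w.
    exponent-upper : ∀ k w → k + w ≡ N → w * (s * N) + (N + k) * a + s * choose2 (N + k) ≡ E + cPlus k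
    exponent-upper k w k+w≡N = begin
      w * (s * N) + (N + k) * a + s * choose2 (N + k)
        ≡⟨ cong (λ M → w * (s * M) + (M + k) * a + s * choose2 (M + k)) (sym k+w≡N) ⟩
      w * (s * (k + w)) + ((k + w) + k) * a + s * choose2 ((k + w) + k)
        ≡⟨ cong (λ x → w * (s * (k + w)) + ((k + w) + k) * a + s * x) (choose2-+ (k + w) k) ⟩
      w * (s * (k + w)) + ((k + w) + k) * a + s * (choose2 (k + w) + choose2 k + (k + w) * k)
        ≡⟨ rearrange a b k w (choose2 (k + w)) (choose2 k) ⟩
      (a * (k + w) + s * choose2 (k + w) + (k + w) * (s * (k + w))) + cPlus k
        ≡⟨ cong (λ M → a * M + s * choose2 M + M * (s * M) + cPlus k) k+w≡N ⟩
      E + cPlus k ∎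
      where
      open ≡-Reasoning
      rearrange : ∀ a b k w cN ck →
        w * ((a + b) * (k + w)) + ((k + w) + k) * a + (a + b) * (cN + ck + (k + w) * k)
          ≡ (a * (k + w) + (a + b) * cN + (k + w) * ((a + b) * (k + w))) + (a * k + (a + b) * ck)
      rearrange = solve-∀

    exponent-lower : ∀ m w → m + w ≡ N → (N + m) * (s * N) + w * a + s * choose2 w ≡ E + cMinus m
    exponent-lower m w m+w≡N = begin
      (N + m) * (s * N) + w * a + s * choose2 w
        ≡⟨ cong (λ M → (M + m) * (s * M) + w * a + s * choose2 w) (sym m+w≡N) ⟩
      ((m + w) + m) * (s * (m + w)) + w * a + s * choose2 w
        ≡⟨ expand a b m w (choose2 w) ⟩
      Q + s * (m * m)
        ≡⟨ cong (λ x → Q + s * x) (choose2-square m) ⟩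
      Q + s * (choose2 m + choose2 m + m)
        ≡⟨ sym (collect a b m w (choose2 m) (choose2 w)) ⟩
      (a * (m + w) + s * (choose2 m + choose2 w + m * w) + (m + w) * (s * (m + w))) + cMinus m
        ≡⟨ cong (λ x → a * (m + w) + s * x + (m + w) * (s * (m + w)) + cMinus m) (sym (choose2-+ m w)) ⟩
      (a * (m + w) + s * choose2 (m + w) + (m + w) * (s * (m + w))) + cMinus m
        ≡⟨ cong (λ M → a * M + s * choose2 M + M * (s * M) + cMinus m) m+w≡N ⟩
      E + cMinus m ∎
      where
      open ≡-Reasoning
      Q : ℕ
      Q = s * (m * m + 3 * m * w + w * w) + w * a + s * choose2 w
      expand : ∀ a b m w cw → ((m + w) + m) * ((a + b) * (m + w)) + w * a + (a + b) * cw
        ≡ ((a + b) * (m * m + 3 * m * w + w * w) + w * a + (a + b) * cw) + (a + b) * (m * m)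
      expand = solve-∀
      collect : ∀ a b m w cm cw →
        (a * (m + w) + (a + b) * (cm + cw + m * w) + (m + w) * ((a + b) * (m + w))) + (b * m + (a + b) * cm)
          ≡ ((a + b) * (m * m + 3 * m * w + w * w) + w * a + (a + b) * cw) + (a + b) * (cm + cm + m)
      collect = solve-∀

    g : ℕ → ℕ
    g i = s * suc i

    term-∏-low : ∀ L u r w c d → 0 < s → u ≤ L → w ≤ u → w ≤ r →
      u * (s * N) + r * a + s * choose2 r ≡ E + c → d ≤ c + w →
      ∏ L g (term u r) ≈[ E + d ] shift E (shift c 𝟙)
    term-∏-low L u r w c d 0<s u≤L w≤u w≤r ex≡ d≤c+w = begin
      ∏ L g (shift ex (gauss s u r))   ≈⟨ ≈⇒≈[] (IsMultiplier.shift-hom (∏-multiplier L g) ex _) ⟩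
      shift ex (∏ L g (gauss s u r))   ≈⟨ shift-raises ex (gauss-∏-low s L u r w 0<s u≤L w≤u w≤r) bound ⟩
      shift ex 𝟙                       ≈⟨ ≈⇒≈[] (shift-≡ 𝟙 ex≡) ⟩
      shift (E + c) 𝟙                  ≈⟨ ≈⇒≈[] (≈-sym (shift-+ E c 𝟙)) ⟩
      shift E (shift c 𝟙)              ∎
      where
      open ≈[_]-Reasoning (E + d)
      ex : ℕ
      ex = u * (s * N) + r * a + s * choose2 r
      bound : E + d ≤ ex + w
      bound = subst (λ x → E + d ≤ x + w) (sym ex≡) (≤-trans (+-monoʳ-≤ E d≤c+w) (≤-reflexive (sym (+-assoc E c w))))

    Ψ : ℕ → ℕ → Series
    Ψ L r = ∏ L g (term ((N + N) ∸ r) r)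

    expansion : ∀ L → shift E (∏ L g jacobiProd) ≈ ⨁ N (λ i → Ψ L (N ∸ suc i)) ⊕ ⨁ (suc N) (λ k → Ψ L (N + k))
    expansion L = begin
      shift E (∏ L g jacobiProd)              ≈⟨ ≈-sym (IsMultiplier.shift-hom (∏-multiplier L g) E jacobiProd) ⟩
      ∏ L g (shift E jacobiProd)              ≈⟨ ∏-resp L g (≈-sym linearProd-factor) ⟩
      ∏ L g (linearProd (N + N))              ≈⟨ ∏-resp L g (q-binomial (N + N)) ⟩
      ∏ L g (diag (N + N) term)               ≈⟨ diag-hom (∏-multiplier L g) (N + N) term ⟩
      diag (N + N) (λ u r → ∏ L g (term u r)) ≈⟨ diag-as-⨁ (N + N) _ ⟩
      ⨁ (suc (N + N)) (Ψ L)                   ≈⟨ ≈-reflexive (cong (λ x → ⨁ x (Ψ L)) (sym (+-suc N N))) ⟩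
      ⨁ (N + suc N) (Ψ L)                     ≈⟨ ⨁-split N (suc N) (Ψ L) ⟩
      ⨁ N (Ψ L) ⊕ ⨁ (suc N) (λ k → Ψ L (N + k)) ≈⟨ ⊕-cong (⨁-reverse N (Ψ L)) (≈-refl {⨁ (suc N) (λ k → Ψ L (N + k))}) ⟩
      ⨁ N (λ i → Ψ L (N ∸ suc i)) ⊕ ⨁ (suc N) (λ k → Ψ L (N + k)) ∎
      where open ≈-Reasoning

    upper-term : ∀ L d k → N + N ≤ L → d ≤ N → 0 < a → k ≤ N → Ψ L (N + k) ≈[ E + d ] shift E (plus k)
    upper-term L d k 2N≤L d≤N 0<a k≤N with m≤n⇒∃[o]m+o≡n k≤N
    ... | w , k+w≡N = ≈[]-trans (≈⇒≈[] (≈-reflexive (cong (λ u → ∏ L g (term u (N + k))) u≡)))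
      (term-∏-low L w (N + k) w (cPlus k) d (<-≤-trans 0<a (m≤m+n a b)) w≤L ≤-refl (≤-trans w≤N (m≤m+n N k))
                  (exponent-upper k w k+w≡N) bound)
      where
      w≤N : w ≤ N
      w≤N = subst (w ≤_) k+w≡N (m≤n+m w k)
      w≤L : w ≤ L
      w≤L = ≤-trans w≤N (≤-trans (m≤m+n N N) 2N≤L)
      u≡ : (N + N) ∸ (N + k) ≡ w
      u≡ = trans ([m+n]∸[m+o]≡n∸o N N k) (trans (cong (_∸ k) (sym k+w≡N)) (m+n∸m≡n k w))
      bound : d ≤ cPlus k + w
      bound = ≤-trans d≤N (subst (_≤ cPlus k + w) k+w≡N (+-monoˡ-≤ w (≤-trans (m≤n*m k a {{>-nonZero 0<a}}) (m≤m+n (a * k) _))))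

    lower-term : ∀ L d i → N + N ≤ L → d ≤ N → 0 < a → 0 < b → i < N → Ψ L (N ∸ suc i) ≈[ E + d ] shift E (minus i)
    lower-term L d i 2N≤L d≤N 0<a 0<b i<N with m≤n⇒∃[o]m+o≡n i<N
    ... | w , m+w≡N = ≈[]-trans (≈⇒≈[] (≈-reflexive (cong₂ (λ u r → ∏ L g (term u r)) (trans (cong ((N + N) ∸_) r≡) u≡) r≡)))
      (term-∏-low L (N + m) w w (cMinus m) d (<-≤-trans 0<a (m≤m+n a b)) u≤L (≤-trans w≤N (m≤m+n N m)) ≤-refl
                  (exponent-lower m w m+w≡N) bound)
      where
      m : ℕ
      m = suc i
      w≤N : w ≤ N
      w≤N = subst (w ≤_) m+w≡N (m≤n+m w m)
      u≤L : N + m ≤ L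
      u≤L = ≤-trans (+-monoʳ-≤ N (subst (m ≤_) m+w≡N (m≤m+n m w))) 2N≤L
      r≡ : N ∸ m ≡ w
      r≡ = trans (cong (_∸ m) (sym m+w≡N)) (m+n∸m≡n m w)
      u≡ : (N + N) ∸ w ≡ N + m
      u≡ = trans (cong (λ x → (N + x) ∸ w) (sym m+w≡N)) (trans (cong (_∸ w) (sym (+-assoc N m w))) (m+n∸n≡m (N + m) w))
      bound : d ≤ cMinus m + w
      bound = ≤-trans d≤N (subst (_≤ cMinus m + w) m+w≡N (+-monoˡ-≤ w (≤-trans (m≤n*m m b {{>-nonZero 0<b}}) (m≤m+n (b * m) _))))

    jacobi : ∀ L d → N + N ≤ L → d ≤ N → 0 < a → 0 < b →
      ∏ L g jacobiProd ≈[ d ] ⨁ (suc N) plus ⊕ ⨁ N minus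
    jacobi L d 2N≤L d≤N 0<a 0<b = shift-cancel E (begin
      shift E (∏ L g jacobiProd)                                            ≈⟨ ≈⇒≈[] (expansion L) ⟩
      ⨁ N (λ i → Ψ L (N ∸ suc i)) ⊕ ⨁ (suc N) (λ k → Ψ L (N + k))          ≈⟨ ⊕-congᵗ (⨁-congᵗ N lower) (⨁-congᵗ (suc N) upper) ⟩
      ⨁ N (λ i → shift E (minus i)) ⊕ ⨁ (suc N) (λ k → shift E (plus k))  ≈⟨ ≈⇒≈[] (⊕-cong (≈-sym (shift-⨁ N minus)) (≈-sym (shift-⨁ (suc N) plus))) ⟩
      shift E (⨁ N minus) ⊕ shift E (⨁ (suc N) plus)                        ≈⟨ ≈⇒≈[] (≈-sym (shift-⊕ E (⨁ N minus) (⨁ (suc N) plus))) ⟩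
      shift E (⨁ N minus ⊕ ⨁ (suc N) plus)                                  ≈⟨ ≈⇒≈[] (shift-resp E (⊕-comm (⨁ N minus) (⨁ (suc N) plus))) ⟩
      shift E (⨁ (suc N) plus ⊕ ⨁ N minus)                                  ∎)
      where
      open ≈[_]-Reasoning (E + d)
      shift-⨁ : ∀ R F → shift E (⨁ R F) ≈ ⨁ R (shift E ∘ F)
      shift-⨁ = IsMultiplier.⨁-hom (shift-multiplier E)
      upper : ∀ k → k < suc N → Ψ L (N + k) ≈[ E + d ] shift E (plus k)
      upper k k<1+N = upper-term L d k 2N≤L d≤N 0<a (≤-pred k<1+N)
      lower : ∀ i → i < N → Ψ L (N ∸ suc i) ≈[ E + d ] shift E (minus i)
      lower i i<N = lower-term L d i 2N≤L d≤N 0<a 0<b i<N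

  even-or-odd : ∀ j → ∃ λ t → j ≡ t * 2 ⊎ j ≡ suc (t * 2)
  even-or-odd zero = 0 , inj₁ refl
  even-or-odd (suc j) with even-or-odd j
  ... | t , inj₁ refl = t , inj₂ refl
  ... | t , inj₂ refl = suc t , inj₁ refl

  genPent-even : ∀ t → genPent (t * 2) ≡ 3 * choose2 t + 2 * t
  genPent-even t = trans (cong (λ r → if r ≡ᵇ 0 then (6 * (j * j) + 4 * j) / 16 else (6 * (j * j) + 8 * j + 2) / 16) (m*n%n≡0 t 2))
                         (trans (cong (_/ 16) numerator) (m*n/n≡m (3 * choose2 t + 2 * t) 16))
    where
    j : ℕ
    j = t * 2
    expand : ∀ t → 6 * ((t * 2) * (t * 2)) + 4 * (t * 2) ≡ 24 * (t * t) + 8 * t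
    expand = solve-∀
    collect : ∀ t c → 24 * (c + c + t) + 8 * t ≡ (3 * c + 2 * t) * 16
    collect = solve-∀
    numerator : 6 * (j * j) + 4 * j ≡ (3 * choose2 t + 2 * t) * 16
    numerator = trans (expand t) (trans (cong (λ x → 24 * x + 8 * t) (choose2-square t)) (collect t (choose2 t)))

  genPent-odd : ∀ t → genPent (suc (t * 2)) ≡ 3 * choose2 (suc t) + suc t
  genPent-odd t = trans (cong (λ r → if r ≡ᵇ 0 then (6 * (j * j) + 4 * j) / 16 else (6 * (j * j) + 8 * j + 2) / 16) ([m+kn]%n≡m%n 1 t 2))
                        (trans (cong (_/ 16) numerator) (m*n/n≡m (3 * choose2 (suc t) + suc t) 16))
    where
    j : ℕ
    j = suc (t * 2)
    expand : ∀ t → 6 * (suc (t * 2) * suc (t * 2)) + 8 * suc (t * 2) + 2 ≡ 24 * (t * t) + 40 * t + 16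
    expand = solve-∀
    collect : ∀ t c → 24 * (c + c + t) + 40 * t + 16 ≡ (3 * (t + c) + suc t) * 16
    collect = solve-∀
    numerator : 6 * (j * j) + 8 * j + 2 ≡ (3 * choose2 (suc t) + suc t) * 16
    numerator = trans (expand t) (trans (cong (λ x → 24 * x + 40 * t + 16) (choose2-square t)) (collect t (choose2 t)))

  -- 4 π_j ≥ j, so only j ≤ d contribute to Σ_j q^(4π_j) up to degree d.
  index≤4genPent : ∀ j → j ≤ 4 * genPent j
  index≤4genPent j with even-or-odd j
  ... | t , inj₁ refl = subst (t * 2 ≤_) (sym (trans (cong (4 *_) (genPent-even t)) (rearrange t (choose2 t)))) (m≤m+n (t * 2) _)
    where
    rearrange : ∀ t c → 4 * (3 * c + 2 * t) ≡ t * 2 + (12 * c + 6 * t)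
    rearrange = solve-∀
  ... | t , inj₂ refl = subst (suc (t * 2) ≤_) (sym (trans (cong (4 *_) (genPent-odd t)) (rearrange t (choose2 t)))) (m≤m+n (suc (t * 2)) _)
    where
    rearrange : ∀ t c → 4 * (3 * (t + c) + suc t) ≡ suc (t * 2) + (12 * c + 14 * t + 3)
    rearrange = solve-∀

  ⨁-interleave : ∀ N P M G → G 0 ≈ P 0 → (∀ t → G (suc (t * 2)) ≈ P (suc t)) → (∀ t → G (suc (suc (t * 2))) ≈ M t) →
    ⨁ (suc N) P ⊕ ⨁ N M ≈ ⨁ (suc (N * 2)) G
  ⨁-interleave N P M G at0 atOdd atEven = begin
    (P 0 ⊕ ⨁ N (P ∘ suc)) ⊕ ⨁ N M                   ≈⟨ ⊕-assoc (P 0) _ _ ⟩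
    P 0 ⊕ (⨁ N (P ∘ suc) ⊕ ⨁ N M)                   ≈⟨ ⊕-cong (≈-sym at0) (≈-sym (⨁-⊕ N (P ∘ suc) M)) ⟩
    G 0 ⊕ ⨁ N (λ t → P (suc t) ⊕ M t)               ≈⟨ ⊕-cong (≈-refl {G 0}) (⨁-cong N (λ t _ → ≈-sym (⊕-cong (atOdd t) (atEven t)))) ⟩
    G 0 ⊕ ⨁ N (λ t → G (suc (t * 2)) ⊕ G (suc (suc (t * 2)))) ≈⟨ ≈-sym (⨁-pairs N G) ⟩
    ⨁ (suc (N * 2)) G                               ∎
    where open ≈-Reasoning

  pentSum : ℕ → Series → Series
  pentSum M f = ⨁ M (λ j → shift (4 * genPent j) f)

  triangleSum : ℕ → Series
  triangleSum N = ⨁ (suc (N * 2)) (λ k → shift (choose2 (suc k)) 𝟙)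

  q4Prod : ℕ → Series → Series
  q4Prod N = ∏ (N * 3) (λ i → 4 * suc i)

  -- Euler's pentagonal number theorem over F₂, at q⁴ (the triple product with a = 4, b = 8):
  -- Σ_{j ≤ 2N} q^(4π_j) ≡ ∏_{i ≤ 3N} (1 + q^(4i)) modulo q^(d+1), for d ≤ N.
  pentagonal : ∀ N d → d ≤ N → pentSum (suc (N * 2)) 𝟙 ≈[ d ] q4Prod N 𝟙
  pentagonal N d d≤N = ≈[]-sym (begin
    q4Prod N 𝟙                                            ≈⟨ ≈⇒≈[] (∏-triples N _ 𝟙) ⟩
    ∏ N (λ t → 4 * suc (t * 3)) (∏ N (λ t → 4 * suc (suc (t * 3))) (∏ N (λ t → 4 * suc (suc (suc (t * 3)))) 𝟙))
      ≈⟨ ≈⇒≈[] (≈-trans (∏-ext N _ (λ t _ → e₁ t)) (∏-resp N a12 (≈-trans (∏-ext N _ (λ t _ → e₂ t)) (∏-resp N b12 (∏-ext N 𝟙 (λ t _ → e₃ t)))))) ⟩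
    ∏ N a12 (∏ N b12 (∏ N g 𝟙))                         ≈⟨ ≈⇒≈[] (∏-resp N a12 (≈-sym (∏-commute (∏-multiplier N g) N b12 𝟙))) ⟩
    ∏ N a12 (∏ N g (∏ N b12 𝟙))                           ≈⟨ ≈⇒≈[] (≈-sym (∏-commute (∏-multiplier N g) N a12 _)) ⟩
    ∏ N g jacobiProd                                      ≈⟨ ∏-respᵗ N g (≈[]-sym (∏-below N (λ i → g (N + i)) jacobiProd (λ i _ → high i))) ⟩
    ∏ N g (∏ N (λ i → g (N + i)) jacobiProd)              ≈⟨ ≈⇒≈[] (≈-sym (∏-split N N g jacobiProd)) ⟩
    ∏ (N + N) g jacobiProd                                ≈⟨ jacobi (N + N) d ≤-refl d≤N (s≤s z≤n) (s≤s z≤n) ⟩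
    ⨁ (suc N) plus ⊕ ⨁ N minus
      ≈⟨ ≈⇒≈[] (⨁-interleave N plus minus (λ j → shift (4 * genPent j) 𝟙) ≈-refl
                  (λ t → shift-≡ 𝟙 (trans (cong (4 *_) (genPent-odd t)) (f₁ t (choose2 (suc t)))))
                  (λ t → shift-≡ 𝟙 (trans (cong (4 *_) (genPent-even (suc t))) (f₂ t (choose2 (suc t)))))) ⟩
    pentSum (suc (N * 2)) 𝟙                              ∎)
    where
    open ≈[_]-Reasoning d
    open TripleProduct 4 8 N using (jacobi; jacobiProd; g; plus; minus)
    a12 b12 : ℕ → ℕ
    a12 t = 4 + 12 * t
    b12 t = 8 + 12 * t
    high : ∀ i → d < g (N + i)
    high i = ≤-trans (s≤s (≤-trans d≤N (m≤m+n N i))) (m≤n*m (suc (N + i)) 12)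
    e₁ : ∀ t → 4 * suc (t * 3) ≡ 4 + 12 * t
    e₁ = solve-∀
    e₂ : ∀ t → 4 * suc (suc (t * 3)) ≡ 8 + 12 * t
    e₂ = solve-∀
    e₃ : ∀ t → 4 * suc (suc (suc (t * 3))) ≡ 12 * suc t
    e₃ = solve-∀
    f₁ : ∀ t c → 4 * (3 * c + suc t) ≡ 4 * suc t + 12 * c
    f₁ = solve-∀
    f₂ : ∀ t c → 4 * (3 * c + 2 * suc t) ≡ 8 * suc t + 12 * c
    f₂ = solve-∀

  -- Gauss's identity Σ_k q^(k(k+1)/2) = (q⁴; q⁴)_∞ (-q; q²)_∞ over F₂ (the triple product with
  -- a = 1, b = 3): ∏_{i ≤ 3N} (1 + q^(4i)) ∏_{i ≤ 2N} (1 + q^(2i-1)) ≡ Σ_{k ≤ 2N} q^(k(k+1)/2).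
  theta : ∀ N d → d ≤ N → q4Prod N (oddBinoms 1 (N * 2) 𝟙) ≈[ d ] triangleSum N
  theta N d d≤N = begin
    q4Prod N (oddBinoms 1 (N * 2) 𝟙)
      ≈⟨ ≈⇒≈[] (∏-resp (N * 3) g (≈-trans (∏-pairs N _ 𝟙) (≈-trans (∏-ext N _ (λ t _ → e₁ t)) (∏-resp N _ (∏-ext N 𝟙 (λ t _ → e₂ t)))))) ⟩
    ∏ (N * 3) g jacobiProd
      ≈⟨ jacobi (N * 3) d 2N≤3N d≤N (s≤s z≤n) (s≤s z≤n) ⟩
    ⨁ (suc N) plus ⊕ ⨁ N minus
      ≈⟨ ≈⇒≈[] (⨁-interleave N plus minus (λ k → shift (choose2 (suc k)) 𝟙) ≈-refl
                  (λ t → shift-≡ 𝟙 (trans (cong (λ c → suc (t * 2) + (t * 2 + c)) (choose2-double t)) (f₁ t (choose2 t))))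
                  (λ t → shift-≡ 𝟙 (trans (cong (λ c → suc (suc (t * 2)) + (suc (t * 2) + (t * 2 + c))) (choose2-double t)) (f₂ t (choose2 t))))) ⟩
    triangleSum N ∎
    where
    open ≈[_]-Reasoning d
    open TripleProduct 1 3 N using (jacobi; jacobiProd; g; plus; minus)
    2N≤3N : N + N ≤ N * 3
    2N≤3N = subst (N + N ≤_) (sym (triple N)) (m≤m+n (N + N) N)
      where
      triple : ∀ N → N * 3 ≡ N + N + N
      triple = solve-∀
    choose2-double : ∀ t → choose2 (t * 2) ≡ 4 * choose2 t + t
    choose2-double t = trans (cong choose2 (*-comm t 2)) (trans (cong (λ x → choose2 (t + x)) (+-identityʳ t))
      (trans (choose2-+ t t) (trans (cong (choose2 t + choose2 t +_) (choose2-square t)) (collect t (choose2 t)))))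
      where
      collect : ∀ t c → c + c + (c + c + t) ≡ 4 * c + t
      collect = solve-∀
    e₁ : ∀ t → 1 * suc ((t * 2) * 2) ≡ 1 + 4 * t
    e₁ = solve-∀
    e₂ : ∀ t → 1 * suc (suc (t * 2) * 2) ≡ 3 + 4 * t
    e₂ = solve-∀
    f₁ : ∀ t c → suc (t * 2) + (t * 2 + (4 * c + t)) ≡ 1 * suc t + 4 * (t + c)
    f₁ = solve-∀
    f₂ : ∀ t c → suc (suc (t * 2)) + (suc (t * 2) + (t * 2 + (4 * c + t))) ≡ 3 * suc t + 4 * (t + c)
    f₂ = solve-∀

  partitionSeries : Series
  partitionSeries n = parity (partitions n)

  -- Multiply both sides by (q; q)_K ≡ ∏_{i ≤ K} (1 + qⁱ), which can be cancelled again.  On the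
  -- left it turns the partition series into 1, leaving the pentagonal sum, i.e. (q⁴; q⁴).
  -- Euler's identity rewrites this as (q; q) · (q⁴; q⁴)(-q; q²), and by Gauss's identity
  -- the second factor is the triangular sum.
  main-identity : ∀ n M → n < M → pentSum M partitionSeries ≈[ n ] triangleSum (suc n)
  main-identity n M n<M =
    ≈[]-trans (IsMultiplier.respᵗ (pentSum-multiplier M) stable) (∏-cancel K suc (λ _ _ → s≤s z≤n) (begin
      D (pentSum M (partsSeries K))               ≈⟨ ≈⇒≈[] (≈-sym (∏-commute (pentSum-multiplier M) K suc (partsSeries K))) ⟩
      pentSum M (D (partsSeries K))               ≈⟨ ≈⇒≈[] (IsMultiplier.resp (pentSum-multiplier M) (partsSeries-∏ K)) ⟩
      pentSum M 𝟙                                 ≈⟨ ⨁-truncate M (suc (N * 2)) _ n n<M n<2N+1 beyond ⟩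
      pentSum (suc (N * 2)) 𝟙                     ≈⟨ pentagonal N n n≤N ⟩
      q4Prod N 𝟙                                  ≈⟨ ∏-respᵗ (N * 3) (λ i → 4 * suc i) (≈[]-sym euler′) ⟩
      q4Prod N (D (oddBinoms 1 K 𝟙))              ≈⟨ ≈⇒≈[] (∏-commute (∏-multiplier (N * 3) (λ i → 4 * suc i)) K suc (oddBinoms 1 K 𝟙)) ⟩
      D (q4Prod N (oddBinoms 1 K 𝟙))              ≈⟨ ∏-respᵗ K suc (theta N n n≤N) ⟩
      D (triangleSum N)                           ∎))
    where
    open ≈[_]-Reasoning n
    N K : ℕ
    N = suc n
    K = N * 2
    D : Series → Series
    D = ∏ K suc
    n≤N : n ≤ N
    n≤N = n≤1+n n
    n<K : n < K
    n<K = s≤s (≤-trans (m≤m*n n 2) (n≤1+n _))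
    n<2N+1 : n < suc (N * 2)
    n<2N+1 = <-trans n<K (n<1+n K)
    pentSum-multiplier : ∀ M → IsMultiplier (pentSum M)
    pentSum-multiplier M = ⨁-multiplier M (λ j → shift-multiplier (4 * genPent j))
    stable : partitionSeries ≈[ n ] partsSeries K
    stable m m≤n = cong parity (sym (partsAtMost-stable m K (≤-trans m≤n (<⇒≤ n<K))))
    beyond : ∀ j → n < j → shift (4 * genPent j) 𝟙 ≈[ n ] 𝟘
    beyond j n<j = shift-vanishes (4 * genPent j) 𝟙 (<-≤-trans n<j (index≤4genPent j))
    euler′ : D (oddBinoms 1 K 𝟙) ≈[ n ] 𝟙
    euler′ = ≈[]-trans (≈⇒≈[] (∏-ext K _ (λ i _ → sym (*-identityˡ (suc i)))))
                       (euler 1 K 𝟙 n (s≤s z≤n) (subst (n <_) (sym (*-identityˡ (suc K))) (<-trans n<K (n<1+n K))))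

  ⨁-none : ∀ R F n → (∀ j → j < R → F j n ≡ false) → ⨁ R F n ≡ false
  ⨁-none zero    F n p = refl
  ⨁-none (suc R) F n p = cong₂ _xor_ (p 0 (s≤s z≤n)) (⨁-none R (F ∘ suc) n (λ j j<R → p (suc j) (s≤s j<R)))

  ⨁-one : ∀ R F n i → i < R → F i n ≡ true → (∀ j → j < R → j ≢ i → F j n ≡ false) → ⨁ R F n ≡ true
  ⨁-one (suc R) F n zero    _         hit others =
    cong₂ _xor_ hit (⨁-none R (F ∘ suc) n (λ j j<R → others (suc j) (s≤s j<R) (λ ())))
  ⨁-one (suc R) F n (suc i) (s≤s i<R) hit others =
    cong₂ _xor_ (others 0 (s≤s z≤n) (λ ())) (⨁-one R (F ∘ suc) n i i<R hit (λ j j<R j≢i → others (suc j) (s≤s j<R) (j≢i ∘ suc-injective)))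

  triangular-< : ∀ i j → i < j → choose2 (suc i) < choose2 (suc j)
  triangular-< i (suc j) (s≤s i≤j) with m≤n⇒m<n∨m≡n i≤j
  ... | inj₁ i<j  = <-≤-trans (triangular-< i j i<j) (m≤n+m (choose2 (suc j)) (suc j))
  ... | inj₂ refl = s≤s (m≤n+m (choose2 (suc i)) i)

  triangular-injective : ∀ i j → choose2 (suc i) ≡ choose2 (suc j) → i ≡ j
  triangular-injective i j eq with <-cmp i j
  ... | tri< i<j _ _ = contradiction eq (<⇒≢ (triangular-< i j i<j))
  ... | tri≈ _ i≡j _ = i≡j
  ... | tri> _ _ j<i = contradiction (sym eq) (<⇒≢ (triangular-< j i j<i))

  triangleSum-triangular : ∀ N n k → n ≡ choose2 (suc k) → n < suc (N * 2) → triangleSum N n ≡ true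
  triangleSum-triangular N n k n≡T n<2N+1 = ⨁-one (suc (N * 2)) (λ i → shift (choose2 (suc i)) 𝟙) n k k<2N+1
    (subst (λ x → shift (choose2 (suc k)) 𝟙 x ≡ true) (sym n≡T) (monomial-at (choose2 (suc k))))
    (λ j _ j≢k → monomial-off (choose2 (suc j)) n (λ T≡n → j≢k (triangular-injective j k (trans T≡n n≡T))))
    where
    k<2N+1 : k < suc (N * 2)
    k<2N+1 = ≤-<-trans (subst (k ≤_) (sym n≡T) (m≤m+n k (choose2 k))) n<2N+1

  triangleSum-not-triangular : ∀ N n → (∀ k → n ≢ choose2 (suc k)) → triangleSum N n ≡ false
  triangleSum-not-triangular N n notT =
    ⨁-none (suc (N * 2)) (λ i → shift (choose2 (suc i)) 𝟙) n (λ j _ → monomial-off (choose2 (suc j)) n (λ T≡n → notT j (sym T≡n)))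

  triangular-closed-form : ∀ k → (k * suc k) / 2 ≡ choose2 (suc k)
  triangular-closed-form k =
    trans (cong (_/ 2) (trans (expand k) (trans (cong (_+ k) (choose2-square k)) (collect k (choose2 k)))))
          (m*n/n≡m (choose2 (suc k)) 2)
    where
    expand : ∀ k → k * suc k ≡ k * k + k
    expand = solve-∀
    collect : ∀ k c → (c + c + k) + k ≡ (k + c) * 2
    collect = solve-∀

  %2-parity : ∀ x → x % 2 ≡ (if parity x then 1 else 0)
  %2-parity zero          = refl
  %2-parity (suc zero)    = refl
  %2-parity (suc (suc x)) =
    trans (cong (_% 2) (+-comm 2 x)) (trans ([m+kn]%n≡m%n x 1 2) (trans (%2-parity x)
      (cong (λ b → if b then 1 else 0) (sym (not-involutive (parity x))))))

open Mod2Series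

open import Defs
open import Data.Nat using (ℕ; _*_; _%_)
open import Data.Integer using (ℤ; +_; _-_; _<_)
open import Data.Product using (_×_)
open import Relation.Nullary using (¬_)
open import Relation.Binary.PropositionalEquality using (_≡_)

open import Data.Bool using (false; true; if_then_else_)
open import Data.Integer using (-[1+_]; +<+; -_)
open import Data.Integer.Properties using (+-injective; m-n≡m⊖n; ⊖-≥; ⊖-<)
import Data.Nat as Nat
import Data.Nat.Properties as NatProps
open import Data.Product using (_,_; ∃)
open import Relation.Binary.PropositionalEquality using (refl; sym; trans; cong)
open import Relation.Nullary using (yes; no)

∸-positive : ∀ n e → n Nat.< e → ∃ λ y → e Nat.∸ n ≡ Nat.suc y
∸-positive Nat.zero    (Nat.suc e) _              = e , refl
∸-positive (Nat.suc n) (Nat.suc e) (Nat.s≤s n<e) = ∸-positive n e n<e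

pℤ-shift : ∀ n e → parity (pℤ (+ n - + e)) ≡ shift e partitionSeries n
pℤ-shift n e with e Nat.≤? n
... | yes e≤n with NatProps.m≤n⇒∃[o]m+o≡n e≤n
...   | k , refl = trans (cong (λ z → parity (pℤ z)) (trans (m-n≡m⊖n (e Nat.+ k) e) (trans (⊖-≥ e≤n) (cong +_ (NatProps.m+n∸m≡n e k)))))
                         (sym (shift-at e partitionSeries k))
pℤ-shift n e | no e≰n with ∸-positive n e (NatProps.≰⇒> e≰n)
... | y , e∸n≡1+y = trans (cong (λ z → parity (pℤ z)) (trans (m-n≡m⊖n n e) (trans (⊖-< (NatProps.≰⇒> e≰n)) (cong (λ x → - (+ x)) e∸n≡1+y))))
                          (sym (shift-below e partitionSeries n (NatProps.≰⇒> e≰n)))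

pℤ-negative : ∀ n e → pℤ (-[1+ n ] - + e) ≡ 0
pℤ-negative n Nat.zero    = refl
pℤ-negative n (Nat.suc e) = refl

parity-of-sum : ∀ n M → n Nat.< M → parity (sumBelow M (λ j → pℤ (+ n - + (4 * genPent j)))) ≡ triangleSum (Nat.suc n) n
parity-of-sum n M n<M =
  trans (cong parity (sum-applyUpTo M (λ i → i) term))
        (trans (parity-Σ< M term _ n (λ j → pℤ-shift n (4 * genPent j))) (main-identity n M n<M n NatProps.≤-refl))
  where
  term : ℕ → ℕ
  term j = pℤ (+ n - + (4 * genPent j))

theorem7 : (n : ℤ) (M : ℕ) → n < + M →
    (IsTriangular n → sumBelow M (λ j → pℤ (n - + (4 * genPent j))) % 2 ≡ 1)
    × (¬ IsTriangular n → sumBelow M (λ j → pℤ (n - + (4 * genPent j))) % 2 ≡ 0)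
theorem7 (+ n) M (+<+ n<M) = odd-if-triangular , even-otherwise
  where
  S : ℕ
  S = sumBelow M (λ j → pℤ (+ n - + (4 * genPent j)))
  n<2N+1 : n Nat.< Nat.suc (Nat.suc n * 2)
  n<2N+1 = Nat.s≤s (NatProps.≤-trans (NatProps.m≤m*n n 2) (NatProps.≤-trans (NatProps.n≤1+n _) (NatProps.n≤1+n _)))
  odd-if-triangular : IsTriangular (+ n) → S % 2 ≡ 1
  odd-if-triangular (k , n≡T) = trans (%2-parity S) (cong (λ b → if b then 1 else 0) (trans (parity-of-sum n M n<M)
    (triangleSum-triangular (Nat.suc n) n k (trans (+-injective n≡T) (triangular-closed-form k)) n<2N+1)))
  even-otherwise : ¬ IsTriangular (+ n) → S % 2 ≡ 0
  even-otherwise notT = trans (%2-parity S) (cong (λ b → if b then 1 else 0) (trans (parity-of-sum n M n<M)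
    (triangleSum-not-triangular (Nat.suc n) n (λ k n≡T → notT (k , cong +_ (trans n≡T (sym (triangular-closed-form k))))))))
theorem7 -[1+ n ] M _ =
  (λ { (k , ()) }) ,
  (λ _ → cong (_% 2) (trans (sum-applyUpTo M (λ i → i) _) (Σ<-vanishes M _ (λ j _ → pℤ-negative n (4 * genPent j)))))
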